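{- For any terms $\mathbf t,\mathbf t'$, any context $\Gamma$ and any type $T$ of the calculus $\lambda^{\mathrm{vec}}_{\mathrm R}$: if $\mathbf t\to\mathbf t'$ and $\Gamma\vdash\mathbf t:T$ is derivable, then $\Gamma\vdash\mathbf t':T$ is derivable.
   Context: Fix a commutative ring $(\mathsf S,+,\times)$ of scalars. Terms of $\lambda^{\mathrm{vec}}_{\mathrm R}$: $\mathbf t ::= x\mid \lambda x.\mathbf t\mid (\mathbf t)\,\mathbf t\mid \alpha\cdot\mathbf t\mid \mathbf t+\mathbf t$, with $\alpha\in\mathsf S$ (there is no zero term). Basis terms are variables and abstractions: $\mathbf b ::= x\mid \lambda x.\mathbf t$. The one-step reduction $\to$ is the closure under the contexts $\alpha\cdot[-]$, $\mathbf u+[-]$, $(\mathbf u)\,[-]$, $([-])\,\mathbf u$, $\lambda x.[-]$ of the following rules. Group E: $1\cdot\mathbf t\to\mathbf t$; $\alpha\cdot(\beta\cdot\mathbf t)\to(\alpha\times\beta)\cdot\mathbf t$; $\alpha\cdot(\mathbf t+\mathbf r)\to\alpha\cdot\mathbf t+\alpha\cdot\mathbf r$. Group F: $\alpha\cdot\mathbf t+\beta\cdot\mathbf t\to(\alpha+\beta)\cdot\mathbf t$; $\alpha\cdot\mathbf t+\mathbf t\to(\alpha+1)\cdot\mathbf t$; $\mathbf t+\mathbf t\to(1+1)\cdot\mathbf t$. Group A: $(\mathbf t+\mathbf r)\,\mathbf u\to(\mathbf t)\,\mathbf u+(\mathbf r)\,\mathbf u$; $(\mathbf t)\,(\mathbf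 r+\mathbf u)\to(\mathbf t)\,\mathbf r+(\mathbf t)\,\mathbf u$; $(\alpha\cdot\mathbf t)\,\mathbf r\to\alpha\cdot(\mathbf t)\,\mathbf r$; $(\mathbf t)\,(\alpha\cdot\mathbf r)\to\alpha\cdot(\mathbf t)\,\mathbf r$. Group B: $(\lambda x.\mathbf t)\,\mathbf b\to\mathbf t[\mathbf b/x]$ for $\mathbf b$ a basis term. Types: general types $T::=U\mid\alpha\cdot T\mid T+T\mid \mathbb X$ and unit types $U::=X\mid U\to T\mid\forall X.U\mid\forall\mathbb X.U$, where $X$ ranges over unit type variables and $\mathbb X$ over general type variables. $\equiv$ is the smallest congruence on types with $1\cdot T\equiv T$, $\alpha\cdot(\beta\cdot T)\equiv(\alpha\times\beta)\cdot T$, $\alpha\cdot T+\alpha\cdot R\equiv\alpha\cdot(T+R)$, $\alpha\cdot T+\beta\cdot T\equiv(\alpha+\beta)\cdot T$, $T+R\equiv R+T$, $T+(R+S)\equiv(T+R)+S$. In $T[A/X]$, $A$ is a unit type when $X$ is a unit variable and any type when $X$ is a general variable. A context $\Gamma$ is a finite set of declarations $x:U$ with $U$ unit. Typing rules: (ax) $\Gamma,x:U\vdash x:U$; ($\equiv$) from $\Gamma\vdash\mathbf t:T$ and $R\equiv T$ infer $\Gamma\vdash\mathbf t:R$; ($\to_I$) from $\Gamma,x:U\vdash\mathbf t:T$ infer $\Gamma\vdash\lambda x.\mathbf t:U\to T$; ($\to_E$) from $\Gamma\vdash\mathbf t:\sum_{i=1}^n\alpha_i\cdot\forall\vec X.(U\to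 T_i)$ and $\Gamma\vdash\mathbf r:\sum_{j=1}^m\beta_j\cdot U[\vec A_j/\vec X]$ infer $\Gamma\vdash(\mathbf t)\,\mathbf r:\sum_{i=1}^n\sum_{j=1}^m(\alpha_i\times\beta_j)\cdot T_i[\vec A_j/\vec X]$; ($\forall_I$) from $\Gamma\vdash\mathbf t:\sum_{i=1}^n\alpha_i\cdot U_i$ and $X\notin FV(\Gamma)$ infer $\Gamma\vdash\mathbf t:\sum_{i=1}^n\alpha_i\cdot\forall X.U_i$; ($\forall_E$) from $\Gamma\vdash\mathbf t:\sum_{i=1}^n\alpha_i\cdot\forall X.U_i$ infer $\Gamma\vdash\mathbf t:\sum_{i=1}^n\alpha_i\cdot U_i[A/X]$; ($+_I$) from $\Gamma\vdash\mathbf t:T$ and $\Gamma\vdash\mathbf r:R$ infer $\Gamma\vdash\mathbf t+\mathbf r:T+R$; ($1_E$) from $\Gamma\vdash1\cdot\mathbf t:T$ infer $\Gamma\vdash\mathbf t:T$; ($S$) from $\Gamma\vdash\mathbf t:T_i$ for all $i\in\{1,\dots,n\}$ infer $\Gamma\vdash(\sum_{i=1}^n\alpha_i)\cdot\mathbf t:\sum_{i=1}^n\alpha_i\cdot T_i$. (Here $X$ in $\forall_I,\forall_E$ may be either kind of variable.) -}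

module Defs where

open import Level using (Level; _⊔_)
open import Algebra.Structures using (IsCommutativeRing)
open import Relation.Binary.PropositionalEquality using (_≡_)
open import Data.Nat using (ℕ; zero; suc)
open import Data.List using (List; []; _∷_; foldr)
import Data.List as L
open import Data.List.NonEmpty using (List⁺; _∷_; concatMap)
import Data.List.NonEmpty as L⁺
open import Data.List.Relation.Unary.All using (All; []; _∷_)
import Data.List.NonEmpty.Relation.Unary.All as All⁺
open import Data.Product using (_×_; _,_; proj₁)
open import Function using (id)

-- A commutative ring of scalars, with propositional equality as its
-- equality (the ring is a plain set, so scalars inside terms and types
-- are compared syntactically / by ≡).

record CRing (c : Level) : Set (Level.suc c) where
  field
    Carrier : Set c
    _+_ _*_ : Carrier → Carrier → Carrier
    -_      : Carrier → Carrier
    0# 1#   : Carrier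
    isCommutativeRing : IsCommutativeRing _≡_ _+_ _*_ -_ 0# 1#

-- The calculus λ^vec_R, over a fixed commutative ring R.
-- Binders (term-level λ, type-level ∀X, ∀𝕏) use de Bruijn indices.

module Calculus {c : Level} (R : CRing c) where

  open CRing R renaming (Carrier to S; _+_ to _+ₛ_; _*_ to _×ₛ_; 1# to 1ₛ)

  infixl 5 _⊕_
  infixr 7 _•_

  data Term : Set c where
    var  : ℕ → Term
    ƛ_   : Term → Term
    app  : Term → Term → Term
    _•_  : S → Term → Term
    _⊕_  : Term → Term → Term

  data Basis : Term → Set c where
    var : ∀ x → Basis (var x)
    lam : ∀ t → Basis (ƛ t)

  ext : (ℕ → ℕ) → ℕ → ℕ
  ext ρ zero    = zero
  ext ρ (suc n) = suc (ρ n)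

  rename : (ℕ → ℕ) → Term → Term
  rename ρ (var x)   = var (ρ x)
  rename ρ (ƛ t)     = ƛ rename (ext ρ) t
  rename ρ (app t r) = app (rename ρ t) (rename ρ r)
  rename ρ (α • t)   = α • rename ρ t
  rename ρ (t ⊕ r)   = rename ρ t ⊕ rename ρ r

  exts : (ℕ → Term) → ℕ → Term
  exts σ zero    = var zero
  exts σ (suc n) = rename suc (σ n)

  sub : (ℕ → Term) → Term → Term
  sub σ (var x)   = σ x
  sub σ (ƛ t)     = ƛ sub (exts σ) t
  sub σ (app t r) = app (sub σ t) (sub σ r)
  sub σ (α • t)   = α • sub σ t
  sub σ (t ⊕ r)   = sub σ t ⊕ sub σ r

  single : Term → ℕ → Term
  single b zero    = b
  single b (suc n) = var n

  -- t [ b ]  is  t[b/x]  where x is the variable bound by the enclosing λ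
  _[_] : Term → Term → Term
  t [ b ] = sub (single b) t

  infix 4 _⟶_

  data _⟶_ : Term → Term → Set c where
    E-one   : ∀ {t} → 1ₛ • t ⟶ t
    E-mul   : ∀ {α β t} → α • (β • t) ⟶ (α ×ₛ β) • t
    E-dist  : ∀ {α t r} → α • (t ⊕ r) ⟶ α • t ⊕ α • r
    F-fact  : ∀ {α β t} → α • t ⊕ β • t ⟶ (α +ₛ β) • t
    F-fact¹ : ∀ {α t} → α • t ⊕ t ⟶ (α +ₛ 1ₛ) • t
    F-fact² : ∀ {t} → t ⊕ t ⟶ (1ₛ +ₛ 1ₛ) • t
    A-distl : ∀ {t r u} → app (t ⊕ r) u ⟶ app t u ⊕ app r u
    A-distr : ∀ {t r u} → app t (r ⊕ u) ⟶ app t r ⊕ app t u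
    A-scall : ∀ {α t r} → app (α • t) r ⟶ α • app t r
    A-scalr : ∀ {α t r} → app t (α • r) ⟶ α • app t r
    B-beta  : ∀ {t b} → Basis b → app (ƛ t) b ⟶ t [ b ]
    ξ-scal  : ∀ {α t t'} → t ⟶ t' → α • t ⟶ α • t'
    ξ-plus  : ∀ {u t t'} → t ⟶ t' → u ⊕ t ⟶ u ⊕ t'
    ξ-appr  : ∀ {u t t'} → t ⟶ t' → app u t ⟶ app u t'
    ξ-appl  : ∀ {u t t'} → t ⟶ t' → app t u ⟶ app t' u
    ξ-lam   : ∀ {t t'} → t ⟶ t' → ƛ t ⟶ ƛ t'

  -- Unit types U ::= X | U → T | ∀X.U | ∀𝕏.U
  --         General types T ::= U | α·T | T + T | 𝕏
  -- Unit type variables X and general type variables 𝕏 are two separate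
  -- de Bruijn index spaces.

  infixr 6 _+ᵀ_
  infixr 7 _·ᵀ_
  infixr 5 _⇒_

  mutual
    data UType : Set c where
      uvar : ℕ → UType
      _⇒_  : UType → Type → UType
      ∀ᵤ_  : UType → UType
      ∀ₘ_  : UType → UType

    data Type : Set c where
      ⌜_⌝   : UType → Type
      _·ᵀ_  : S → Type → Type
      _+ᵀ_  : Type → Type → Type
      gvar  : ℕ → Type

  mutual
    renU : (ℕ → ℕ) → (ℕ → ℕ) → UType → UType
    renU ρu ρg (uvar x) = uvar (ρu x)
    renU ρu ρg (U ⇒ T)  = renU ρu ρg U ⇒ renT ρu ρg T
    renU ρu ρg (∀ᵤ U)   = ∀ᵤ renU (ext ρu) ρg U
    renU ρu ρg (∀ₘ U)   = ∀ₘ renU ρu (ext ρg) U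

    renT : (ℕ → ℕ) → (ℕ → ℕ) → Type → Type
    renT ρu ρg ⌜ U ⌝    = ⌜ renU ρu ρg U ⌝
    renT ρu ρg (α ·ᵀ T) = α ·ᵀ renT ρu ρg T
    renT ρu ρg (T +ᵀ R) = renT ρu ρg T +ᵀ renT ρu ρg R
    renT ρu ρg (gvar x) = gvar (ρg x)

  record Env : Set c where
    constructor env
    field
      σu : ℕ → UType
      σg : ℕ → Type
  open Env

  liftᵤ : Env → Env
  liftᵤ (env σu σg) = env su (λ n → renT suc id (σg n))
    where
      su : ℕ → UType
      su zero    = uvar zero
      su (suc n) = renU suc id (σu n)

  liftₘ : Env → Env
  liftₘ (env σu σg) = env (λ n → renU id suc (σu n)) sg
    where
      sg : ℕ → Type
      sg zero    = gvar zero
      sg (suc n) = renT id suc (σg n)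

  mutual
    substU : Env → UType → UType
    substU σ (uvar x) = σu σ x
    substU σ (U ⇒ T)  = substU σ U ⇒ substT σ T
    substU σ (∀ᵤ U)   = ∀ᵤ substU (liftᵤ σ) U
    substU σ (∀ₘ U)   = ∀ₘ substU (liftₘ σ) U

    substT : Env → Type → Type
    substT σ ⌜ U ⌝    = ⌜ substU σ U ⌝
    substT σ (α ·ᵀ T) = α ·ᵀ substT σ T
    substT σ (T +ᵀ R) = substT σ T +ᵀ substT σ R
    substT σ (gvar x) = σg σ x

  idEnv : Env
  idEnv = env uvar gvar

  data Kind : Set where
    unitK genK : Kind

  Arg : Kind → Set c
  Arg unitK = UType
  Arg genK  = Type

  ∀[_]_ : Kind → UType → UType
  ∀[ unitK ] U = ∀ᵤ U
  ∀[ genK  ] U = ∀ₘ U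

  -- ∀X⃗.U  for a telescope X⃗ = X₁ … Xₙ (listed outermost first)
  ∀⃗ : List Kind → UType → UType
  ∀⃗ ks U = foldr ∀[_]_ U ks

  extend : (k : Kind) → Arg k → Env → Env
  extend unitK A (env σu σg) = env su σg
    where
      su : ℕ → UType
      su zero    = A
      su (suc n) = σu n
  extend genK A (env σu σg) = env σu sg
    where
      sg : ℕ → Type
      sg zero    = A
      sg (suc n) = σg n

  -- environment realising [A⃗/X⃗] for the body of ∀X⃗.(…)
  envOf : (ks : List Kind) → All Arg ks → Env → Env
  envOf []       []       e = e
  envOf (k ∷ ks) (A ∷ As) e = envOf ks As (extend k A e)

  -- U[A/X] where X is the variable bound by an enclosing ∀ of kind k
  _[_/]U : ∀ {k} → UType → Arg k → UType
  _[_/]U {k} U A = substU (extend k A idEnv) U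

  substsU : (ks : List Kind) → All Arg ks → UType → UType
  substsU ks As = substU (envOf ks As idEnv)

  substsT : (ks : List Kind) → All Arg ks → Type → Type
  substsT ks As = substT (envOf ks As idEnv)

  sumT : List⁺ (S × Type) → Type
  sumT (x ∷ xs) = go x xs
    where
      go : S × Type → List (S × Type) → Type
      go (α , T) []       = α ·ᵀ T
      go (α , T) (y ∷ ys) = α ·ᵀ T +ᵀ go y ys

  sumU : List⁺ (S × UType) → Type
  sumU xs = sumT (L⁺.map (λ { (α , U) → α , ⌜ U ⌝ }) xs)

  sumS : List⁺ S → S
  sumS (x ∷ xs) = go x xs
    where
      go : S → List S → S
      go α []       = α
      go α (β ∷ βs) = α +ₛ go β βs

  infix 4 _≡ᵀ_

  data _≡ᵀ_ : Type → Type → Set c where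
    ≡-refl  : ∀ {T} → T ≡ᵀ T
    ≡-sym   : ∀ {T R} → T ≡ᵀ R → R ≡ᵀ T
    ≡-trans : ∀ {T R Q} → T ≡ᵀ R → R ≡ᵀ Q → T ≡ᵀ Q
    ≡-one   : ∀ {T} → 1ₛ ·ᵀ T ≡ᵀ T
    ≡-mul   : ∀ {α β T} → α ·ᵀ (β ·ᵀ T) ≡ᵀ (α ×ₛ β) ·ᵀ T
    ≡-dist  : ∀ {α T R} → α ·ᵀ T +ᵀ α ·ᵀ R ≡ᵀ α ·ᵀ (T +ᵀ R)
    ≡-fact  : ∀ {α β T} → α ·ᵀ T +ᵀ β ·ᵀ T ≡ᵀ (α +ₛ β) ·ᵀ T
    ≡-comm  : ∀ {T R} → T +ᵀ R ≡ᵀ R +ᵀ T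
    ≡-assoc : ∀ {T R Q} → T +ᵀ (R +ᵀ Q) ≡ᵀ (T +ᵀ R) +ᵀ Q
    ≡-scal  : ∀ {α T T'} → T ≡ᵀ T' → α ·ᵀ T ≡ᵀ α ·ᵀ T'
    ≡-plus  : ∀ {T T' R R'} → T ≡ᵀ T' → R ≡ᵀ R' → T +ᵀ R ≡ᵀ T' +ᵀ R'
    ≡-arrow : ∀ {U U' T T'} → ⌜ U ⌝ ≡ᵀ ⌜ U' ⌝ → T ≡ᵀ T'
              → ⌜ U ⇒ T ⌝ ≡ᵀ ⌜ U' ⇒ T' ⌝
    ≡-allu  : ∀ {U U'} → ⌜ U ⌝ ≡ᵀ ⌜ U' ⌝ → ⌜ ∀ᵤ U ⌝ ≡ᵀ ⌜ ∀ᵤ U' ⌝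
    ≡-allg  : ∀ {U U'} → ⌜ U ⌝ ≡ᵀ ⌜ U' ⌝ → ⌜ ∀ₘ U ⌝ ≡ᵀ ⌜ ∀ₘ U' ⌝

  Ctx : Set c
  Ctx = List UType

  infix 4 _∋_∶_
  data _∋_∶_ : Ctx → ℕ → UType → Set c where
    here  : ∀ {Γ U} → (U ∷ Γ) ∋ zero ∶ U
    there : ∀ {Γ U V x} → Γ ∋ x ∶ U → (V ∷ Γ) ∋ suc x ∶ U

  -- shifting the free type variables of a context when going under a
  -- type binder of kind k (de Bruijn rendering of  X ∉ FV(Γ))
  wk : Kind → UType → UType
  wk unitK = renU suc id
  wk genK  = renU id suc

  arrowSum : List Kind → UType → List⁺ (S × Type) → Type
  arrowSum ks U αTs = sumU (L⁺.map (λ { (α , T) → α , ∀⃗ ks (U ⇒ T) }) αTs)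

  argSum : (ks : List Kind) → UType → List⁺ (S × All Arg ks) → Type
  argSum ks U βAs = sumU (L⁺.map (λ { (β , As) → β , substsU ks As U }) βAs)

  resSum : (ks : List Kind) → List⁺ (S × Type) → List⁺ (S × All Arg ks) → Type
  resSum ks αTs βAs =
    sumT (concatMap (λ { (α , T) →
            L⁺.map (λ { (β , As) → (α ×ₛ β) , substsT ks As T }) βAs }) αTs)

  infix 4 _⊢_∶_

  data _⊢_∶_ : Ctx → Term → Type → Set c where
    ax   : ∀ {Γ x U} → Γ ∋ x ∶ U → Γ ⊢ var x ∶ ⌜ U ⌝
    ≡-ty : ∀ {Γ t T R} → Γ ⊢ t ∶ T → R ≡ᵀ T → Γ ⊢ t ∶ R
    →I   : ∀ {Γ t U T} → (U ∷ Γ) ⊢ t ∶ T → Γ ⊢ ƛ t ∶ ⌜ U ⇒ T ⌝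
    →E   : ∀ {Γ t r} (ks : List Kind) (U : UType)
             (αTs : List⁺ (S × Type)) (βAs : List⁺ (S × All Arg ks))
           → Γ ⊢ t ∶ arrowSum ks U αTs
           → Γ ⊢ r ∶ argSum ks U βAs
           → Γ ⊢ app t r ∶ resSum ks αTs βAs
    ∀I   : ∀ {Γ t} (k : Kind) (αUs : List⁺ (S × UType))
           → L.map (wk k) Γ ⊢ t ∶ sumU αUs
           → Γ ⊢ t ∶ sumU (L⁺.map (λ { (α , U) → α , ∀[ k ] U }) αUs)
    ∀E   : ∀ {Γ t} (k : Kind) (A : Arg k) (αUs : List⁺ (S × UType))
           → Γ ⊢ t ∶ sumU (L⁺.map (λ { (α , U) → α , ∀[ k ] U }) αUs)
           → Γ ⊢ t ∶ sumU (L⁺.map (λ { (α , U) → α , U [ A /]U }) αUs)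
    +I   : ∀ {Γ t r T R} → Γ ⊢ t ∶ T → Γ ⊢ r ∶ R → Γ ⊢ t ⊕ r ∶ T +ᵀ R
    1E   : ∀ {Γ t T} → Γ ⊢ 1ₛ • t ∶ T → Γ ⊢ t ∶ T
    S-rule : ∀ {Γ t} (αTs : List⁺ (S × Type))
           → All⁺.All (λ { (α , T) → Γ ⊢ t ∶ T }) αTs
           → Γ ⊢ sumS (L⁺.map proj₁ αTs) • t ∶ sumT αTs

-- Typing in this calculus is not syntax directed: the rules for ≡, ∀I, ∀E, 1E and S can be
-- interleaved arbitrarily, so inversion lemmas are replaced by invariants preserved by all of
-- them.  A typing of α • t ∶ X yields typings t ∶ Tᵢ with weights αᵢ summing to α and
-- X ≡ Σ αᵢ·Tᵢ, which rule S turns back into a typing of α • t; a typing of t + r ∶ X likewise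
-- splits X into such a family for t plus one for r.  Since ∀I and ∀E act on unit summands,
-- they are pushed through these families by tracking where the unit summands of X go, and
-- arbitrary ring weights are rebuilt from weight-one typings as γ·T = 1·T + (γ - 1)·T.
-- For a basis term b, every unit summand of a type of b is again a type of b and the scalars
-- of the type add up to 1; for λx.t every unit summand is moreover equivalent to some
-- ∀X⃗.(A → B) with t ∶ B[A⃗/X⃗] whenever x ∶ A[A⃗/X⃗].  With these facts every reduction rule
-- rebuilds a typing of the reduct at the same type; for β, the substitution lemma types each
-- instance of the body and rule S collects them with total weight 1.

module Submission where

open import Level using (Level)
open import Defs
open import Algebra.Bundles using (Magma; CommutativeSemigroup; CommutativeRing)
open import Algebra.Core using (Op₂)
open import Relation.Binary.Structures using (IsEquivalence)
import Relation.Binary.Reasoning.Setoid as SetoidReasoning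
import Algebra.Properties.CommutativeSemigroup as CommutativeSemigroupProperties
open import Relation.Binary.PropositionalEquality as P using (_≡_)
open import Data.List using (List; []; _∷_; _++_)
import Data.List as L
import Data.List.Properties as Lₚ
open import Data.List.NonEmpty using (List⁺; _∷_; _⁺++⁺_; concatMap)
import Data.List.NonEmpty as L⁺
import Data.List.NonEmpty.Properties as L⁺ₚ
import Data.List.Relation.Unary.All as All
import Data.List.Relation.Unary.All.Properties as Allₚ
import Data.List.NonEmpty.Relation.Unary.All
open import Data.List.Relation.Binary.Pointwise as Pointwise using (Pointwise; []; _∷_)
open import Data.Product using (_×_; _,_; proj₁; proj₂; Σ)
import Data.Product as Product
open Product using (map₂)
open import Data.Nat using (ℕ; zero; suc)
open import Data.Empty using (⊥)
open import Relation.Nullary using (contradiction)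
open import Data.Sum using (_⊎_; inj₁; [_,_]′)
import Data.Sum as Sum
open import Data.Sum.Function.Propositional using (_⊎-⇔_)
open import Data.Product.Function.NonDependent.Propositional using (_×-⇔_)
import Data.Empty.Polymorphic as Poly
open import Function using (_∘_; id; _⇔_; mk⇔; Equivalence)
open import Function.Properties.Equivalence using (⇔-isEquivalence)

private
  variable
    a b d ℓ : Level
    A B D : Set a

module All⁺ where
  open Data.List.NonEmpty.Relation.Unary.All public

  map : {P : A → Set ℓ} {Q : A → Set b} → (∀ {x} → P x → Q x) → ∀ {L} → All P L → All Q L
  map f (px ∷ pxs) = f px ∷ All.map f pxs

  map⁺ : {P : B → Set ℓ} (f : A → B) → ∀ {L} → All (P ∘ f) L → All P (L⁺.map f L)
  map⁺ f (px ∷ pxs) = px ∷ Allₚ.map⁺ pxs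

  map⁻ : {P : B → Set ℓ} (f : A → B) → ∀ {L} → All P (L⁺.map f L) → All (P ∘ f) L
  map⁻ f {_ ∷ _} (px ∷ pxs) = px ∷ Allₚ.map⁻ pxs

  ++⁺ : {P : A → Set ℓ} → ∀ {L M} → All P L → All P M → All P (L ⁺++⁺ M)
  ++⁺ (px ∷ pxs) (py ∷ pys) = px ∷ Allₚ.++⁺ pxs (py All.∷ pys)

module Sum⁺ {A : Set a} (_∙_ : Op₂ A) where

  ∑∷ : B → List B → (B → A) → A
  ∑∷ x []       f = f x
  ∑∷ x (y ∷ ys) f = f x ∙ ∑∷ y ys f

  ∑ : List⁺ B → (B → A) → A
  ∑ (x ∷ xs) = ∑∷ x xs

  ∑-map : (L : List⁺ B) (g : B → D) (f : D → A) → ∑ (L⁺.map g L) f ≡ ∑ L (f ∘ g)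
  ∑-map (x ∷ xs) g f = go x xs
    where
      go : ∀ x xs → ∑∷ (g x) (L.map g xs) f ≡ ∑∷ x xs (f ∘ g)
      go x []       = P.refl
      go x (y ∷ ys) = P.cong (f (g x) ∙_) (go y ys)

module MagmaSums (M : Magma a ℓ) where
  open Magma M
  open Sum⁺ _∙_

  ∑-cong : (L : List⁺ B) {f g : B → Carrier} → (∀ z → f z ≈ g z) → ∑ L f ≈ ∑ L g
  ∑-cong (x ∷ xs) {f} {g} f≈g = go x xs
    where
      go : ∀ x xs → ∑∷ x xs f ≈ ∑∷ x xs g
      go x []       = f≈g x
      go x (y ∷ ys) = ∙-cong (f≈g x) (go y ys)

  ∑-congᴬ : (L : List⁺ B) {f g : B → Carrier} → All⁺.All (λ z → f z ≈ g z) L → ∑ L f ≈ ∑ L g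
  ∑-congᴬ (x ∷ xs) {f} {g} (fx≈gx All⁺.∷ f≈g) = go x xs fx≈gx f≈g
    where
      go : ∀ x xs → f x ≈ g x → All.All (λ z → f z ≈ g z) xs → ∑∷ x xs f ≈ ∑∷ x xs g
      go x []       fx≈gx All.[]             = fx≈gx
      go x (y ∷ ys) fx≈gx (fy≈gy All.∷ f≈g) = ∙-cong fx≈gx (go y ys fy≈gy f≈g)

  ∑-homo : {_◇_ : Op₂ D} (h : D → Carrier) → (∀ x y → h (x ◇ y) ≈ h x ∙ h y) →
           (L : List⁺ B) (f : B → D) → h (Sum⁺.∑ _◇_ L f) ≈ ∑ L (h ∘ f)
  ∑-homo {_◇_ = _◇_} h h-homo (x ∷ xs) f = go x xs
    where
      go : ∀ x xs → h (Sum⁺.∑∷ _◇_ x xs f) ≈ ∑∷ x xs (h ∘ f)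
      go x []       = refl
      go x (y ∷ ys) = trans (h-homo _ _) (∙-cong refl (go y ys))

module CommutativeSemigroupSums (G : CommutativeSemigroup a ℓ) where
  open CommutativeSemigroup G
  open Sum⁺ _∙_ public
  open MagmaSums magma public
  open CommutativeSemigroupProperties G using (interchange; xy∙z≈xz∙y)

  ∑∷-head : {x x' : B} (xs : List B) {e : Carrier} (f : B → Carrier) →
            f x' ≈ f x ∙ e → ∑∷ x' xs f ≈ ∑∷ x xs f ∙ e
  ∑∷-head []       f fx'≈fx∙e = fx'≈fx∙e
  ∑∷-head (y ∷ ys) f fx'≈fx∙e = trans (∙-cong fx'≈fx∙e refl) (xy∙z≈xz∙y _ _ _)

  ∑-++ : (L M : List⁺ B) (f : B → Carrier) → ∑ (L ⁺++⁺ M) f ≈ ∑ L f ∙ ∑ M f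
  ∑-++ (x ∷ xs) (y ∷ ys) f = go x xs
    where
      go : ∀ x xs → ∑∷ x (xs ++ y ∷ ys) f ≈ ∑∷ x xs f ∙ ∑∷ y ys f
      go x []       = refl
      go x (z ∷ zs) = trans (∙-cong refl (go z zs)) (sym (assoc _ _ _))

  ∑-zip : (L : List⁺ B) (f g : B → Carrier) → ∑ L (λ x → f x ∙ g x) ≈ ∑ L f ∙ ∑ L g
  ∑-zip (x ∷ xs) f g = go x xs
    where
      go : ∀ x xs → ∑∷ x xs (λ x → f x ∙ g x) ≈ ∑∷ x xs f ∙ ∑∷ x xs g
      go x []       = refl
      go x (y ∷ ys) = trans (∙-cong refl (go y ys)) (interchange _ _ _ _)

  ∑-concat : (Ls : List⁺ (List⁺ B)) (f : B → Carrier) → ∑ (L⁺.concat Ls) f ≈ ∑ Ls (λ M → ∑ M f)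
  ∑-concat (X ∷ Xs) f = go X Xs
    where
      go : ∀ X Xs → ∑ (L⁺.concat (X ∷ Xs)) f ≈ ∑∷ X Xs (λ M → ∑ M f)
      go (x ∷ xs) []       = reflexive (P.cong (λ ys → ∑∷ x ys f) (Lₚ.++-identityʳ xs))
      go X        (M ∷ Ms) = trans (∑-++ X (L⁺.concat (M ∷ Ms)) f) (∙-cong refl (go M Ms))

  ∑-concatMap : (L : List⁺ B) (g : B → List⁺ D) (f : D → Carrier) →
                ∑ (concatMap g L) f ≈ ∑ L (λ x → ∑ (g x) f)
  ∑-concatMap L g f = trans (∑-concat (L⁺.map g L) f) (reflexive (∑-map L g (λ M → ∑ M f)))

  ∑-swap : (L : List⁺ B) (M : List⁺ D) (h : B → D → Carrier) →
           ∑ L (λ x → ∑ M (h x)) ≈ ∑ M (λ y → ∑ L (λ x → h x y))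
  ∑-swap (x ∷ xs) M h = go x xs
    where
      go : ∀ x xs → ∑∷ x xs (λ x → ∑ M (h x)) ≈ ∑ M (λ y → ∑∷ x xs (λ x → h x y))
      go x []       = refl
      go x (y ∷ ys) = trans (∙-cong refl (go y ys)) (sym (∑-zip M (h x) _))

module _ {c : Level} (R : CRing c) where

  open CRing R using (isCommutativeRing)
  open Calculus R
  open P using (refl; sym; trans; cong; cong₂; subst)
  open All using (All; []; _∷_)
  module ⇔ {ℓ} = IsEquivalence (⇔-isEquivalence {ℓ})

  ring : CommutativeRing c c
  ring = record { isCommutativeRing = isCommutativeRing }

  open CommutativeRing ring
    renaming (Carrier to S; _+_ to _+ₛ_; _*_ to _×ₛ_; -_ to -ₛ_; 1# to 1ₛ)
    using ( +-assoc; +-comm; *-assoc; *-comm; *-identityˡ; *-identityʳ; distribˡ; distribʳ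
          ; +-group; +-commutativeSemigroup )
  open import Algebra.Properties.Group +-group using (//-rightDividesˡ; //-rightDividesʳ)

  x-y+y≡x : ∀ x y → (x +ₛ (-ₛ y)) +ₛ y ≡ x
  x-y+y≡x x y = //-rightDividesˡ y x

  x+y-y≡x : ∀ x y → (x +ₛ y) +ₛ (-ₛ y) ≡ x
  x+y-y≡x x y = //-rightDividesʳ y x

  1+[x-1]1≡x : ∀ x → 1ₛ +ₛ ((x +ₛ (-ₛ 1ₛ)) ×ₛ 1ₛ) ≡ x
  1+[x-1]1≡x x = trans (cong (1ₛ +ₛ_) (*-identityʳ _)) (trans (+-comm 1ₛ _) (x-y+y≡x x 1ₛ))

  +ᵀ-commutativeSemigroup : CommutativeSemigroup c c
  +ᵀ-commutativeSemigroup = record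
    { _≈_ = _≡ᵀ_
    ; _∙_ = _+ᵀ_
    ; isCommutativeSemigroup = record
      { isSemigroup = record
        { isMagma = record
          { isEquivalence = record { refl = ≡-refl ; sym = ≡-sym ; trans = ≡-trans }
          ; ∙-cong = ≡-plus
          }
        ; assoc = λ _ _ _ → ≡-sym ≡-assoc
        }
      ; comm = λ _ _ → ≡-comm
      }
    }

  +ᵀ-syntacticMagma : Magma c c
  +ᵀ-syntacticMagma = record
    { _≈_ = _≡_
    ; _∙_ = _+ᵀ_
    ; isMagma = record { isEquivalence = P.isEquivalence ; ∙-cong = cong₂ _+ᵀ_ }
    }

  open CommutativeSemigroupSums +ᵀ-commutativeSemigroup using ()
    renaming ( ∑ to ⨁; ∑∷ to ⨁∷; ∑-map to ⨁-map; ∑-cong to ⨁-cong; ∑-congᴬ to ⨁-congᴬ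
             ; ∑-homo to ⨁-homo; ∑∷-head to ⨁∷-head; ∑-++ to ⨁-++
             ; ∑-concatMap to ⨁-concatMap; ∑-swap to ⨁-swap )
  open CommutativeSemigroup +ᵀ-commutativeSemigroup using () renaming (reflexive to ≡-reflexive)
  open CommutativeSemigroupProperties +ᵀ-commutativeSemigroup using () renaming (interchange to interchangeᵀ)

  module ≡ᵀ-Reasoning = SetoidReasoning (CommutativeSemigroup.setoid +ᵀ-commutativeSemigroup)

  open MagmaSums +ᵀ-syntacticMagma using ()
    renaming (∑-cong to ⨁-cong≡; ∑-homo to ⨁-homo≡)
  open CommutativeSemigroupSums +-commutativeSemigroup using ()
    renaming ( ∑ to Σs; ∑∷ to Σs∷; ∑-map to Σs-map; ∑-cong to Σs-cong; ∑-congᴬ to Σs-congᴬ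
             ; ∑-homo to Σs-homo; ∑∷-head to Σs∷-head; ∑-++ to Σs-++ )

  ·ᵀ-distrib-⨁ : ∀ α (L : List⁺ A) (f : A → Type) → α ·ᵀ ⨁ L f ≡ᵀ ⨁ L (λ x → α ·ᵀ f x)
  ·ᵀ-distrib-⨁ α = ⨁-homo (α ·ᵀ_) (λ _ _ → ≡-sym ≡-dist)

  scaled : S × Type → Type
  scaled (α , T) = α ·ᵀ T

  scaledU : S × UType → Type
  scaledU (α , U) = α ·ᵀ ⌜ U ⌝

  sumT≡⨁ : ∀ L → sumT L ≡ ⨁ L scaled
  sumT≡⨁ (x ∷ xs) = go x xs
    where
      go : ∀ x xs → sumT (x ∷ xs) ≡ ⨁∷ x xs scaled
      go x []       = refl
      go x (y ∷ ys) = cong (scaled x +ᵀ_) (go y ys)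

  sumS≡Σs : ∀ L → sumS L ≡ Σs L id
  sumS≡Σs (x ∷ xs) = go x xs
    where
      go : ∀ x xs → sumS (x ∷ xs) ≡ Σs∷ x xs id
      go x []       = refl
      go x (y ∷ ys) = cong (x +ₛ_) (go y ys)

  sumS-map : (L : List⁺ A) (f : A → S) → sumS (L⁺.map f L) ≡ Σs L f
  sumS-map L f = trans (sumS≡Σs (L⁺.map f L)) (Σs-map L f id)

  sumT-map : (L : List⁺ A) (g : A → S) (f : A → Type) →
             sumT (L⁺.map (λ x → g x , f x) L) ≡ ⨁ L (λ x → g x ·ᵀ f x)
  sumT-map L g f = trans (sumT≡⨁ _) (⨁-map L _ scaled)

  sumU≡⨁ : ∀ L → sumU L ≡ ⨁ L scaledU
  sumU≡⨁ L = trans (sumT≡⨁ _) (⨁-map L _ scaled)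

  sumU-map : (L : List⁺ A) (g : A → S) (f : A → UType) →
             sumU (L⁺.map (λ x → g x , f x) L) ≡ ⨁ L (λ x → g x ·ᵀ ⌜ f x ⌝)
  sumU-map L g f = trans (sumU≡⨁ _) (⨁-map L _ scaledU)

  -- Invariants of type equivalence

  mass : Type → S
  mass ⌜ U ⌝    = 1ₛ
  mass (α ·ᵀ T) = α ×ₛ mass T
  mass (T +ᵀ R) = mass T +ₛ mass R
  mass (gvar x) = 1ₛ

  mass-resp : ∀ {T R} → T ≡ᵀ R → mass T ≡ mass R
  mass-resp ≡-refl        = refl
  mass-resp (≡-sym p)     = sym (mass-resp p)
  mass-resp (≡-trans p q) = trans (mass-resp p) (mass-resp q)
  mass-resp ≡-one         = *-identityˡ _
  mass-resp ≡-mul         = sym (*-assoc _ _ _)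
  mass-resp ≡-dist        = sym (distribˡ _ _ _)
  mass-resp ≡-fact        = sym (distribʳ _ _ _)
  mass-resp ≡-comm        = +-comm _ _
  mass-resp ≡-assoc       = sym (+-assoc _ _ _)
  mass-resp (≡-scal p)    = cong (_ ×ₛ_) (mass-resp p)
  mass-resp (≡-plus p q)  = cong₂ _+ₛ_ (mass-resp p) (mass-resp q)
  mass-resp (≡-arrow p q) = refl
  mass-resp (≡-allu p)    = refl
  mass-resp (≡-allg p)    = refl

  mass-⨁ : (L : List⁺ A) (f : A → Type) → mass (⨁ L f) ≡ Σs L (mass ∘ f)
  mass-⨁ = Σs-homo mass (λ _ _ → refl)

  Occurs : ℕ → Type → Set
  Occurs n ⌜ U ⌝    = ⊥
  Occurs n (α ·ᵀ T) = Occurs n T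
  Occurs n (T +ᵀ R) = Occurs n T ⊎ Occurs n R
  Occurs n (gvar m) = n ≡ m

  Occurs-resp : ∀ {n T R} → T ≡ᵀ R → Occurs n T ⇔ Occurs n R
  Occurs-resp ≡-refl        = ⇔.refl
  Occurs-resp (≡-sym p)     = ⇔.sym (Occurs-resp p)
  Occurs-resp (≡-trans p q) = ⇔.trans (Occurs-resp p) (Occurs-resp q)
  Occurs-resp ≡-one         = ⇔.refl
  Occurs-resp ≡-mul         = ⇔.refl
  Occurs-resp ≡-dist        = ⇔.refl
  Occurs-resp ≡-fact        = mk⇔ [ id , id ]′ inj₁
  Occurs-resp ≡-comm        = mk⇔ Sum.swap Sum.swap
  Occurs-resp ≡-assoc       = mk⇔ Sum.assocˡ Sum.assocʳ
  Occurs-resp (≡-scal p)    = Occurs-resp p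
  Occurs-resp (≡-plus p q)  = Occurs-resp p ⊎-⇔ Occurs-resp q
  Occurs-resp (≡-arrow p q) = ⇔.refl
  Occurs-resp (≡-allu p)    = ⇔.refl
  Occurs-resp (≡-allg p)    = ⇔.refl

  gvar-injective : ∀ {n m} → gvar n ≡ᵀ gvar m → n ≡ m
  gvar-injective {n} p = Equivalence.to (Occurs-resp {n} p) refl

  mapUnits : (UType → Type) → Type → Type
  mapUnits f ⌜ U ⌝    = f U
  mapUnits f (α ·ᵀ T) = α ·ᵀ mapUnits f T
  mapUnits f (T +ᵀ R) = mapUnits f T +ᵀ mapUnits f R
  mapUnits f (gvar x) = gvar x

  record UnitCongruent (f : UType → Type) : Set c where
    field
      ⇒-cong  : ∀ {U U' T T'} → ⌜ U ⌝ ≡ᵀ ⌜ U' ⌝ → T ≡ᵀ T' → f (U ⇒ T) ≡ᵀ f (U' ⇒ T')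
      ∀ᵤ-cong : ∀ {U U'} → ⌜ U ⌝ ≡ᵀ ⌜ U' ⌝ → f (∀ᵤ U) ≡ᵀ f (∀ᵤ U')
      ∀ₘ-cong : ∀ {U U'} → ⌜ U ⌝ ≡ᵀ ⌜ U' ⌝ → f (∀ₘ U) ≡ᵀ f (∀ₘ U')

  mapUnits-resp : ∀ {f} → UnitCongruent f → ∀ {T R} → T ≡ᵀ R → mapUnits f T ≡ᵀ mapUnits f R
  mapUnits-resp f-cong ≡-refl        = ≡-refl
  mapUnits-resp f-cong (≡-sym p)     = ≡-sym (mapUnits-resp f-cong p)
  mapUnits-resp f-cong (≡-trans p q) = ≡-trans (mapUnits-resp f-cong p) (mapUnits-resp f-cong q)
  mapUnits-resp f-cong ≡-one         = ≡-one
  mapUnits-resp f-cong ≡-mul         = ≡-mul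
  mapUnits-resp f-cong ≡-dist        = ≡-dist
  mapUnits-resp f-cong ≡-fact        = ≡-fact
  mapUnits-resp f-cong ≡-comm        = ≡-comm
  mapUnits-resp f-cong ≡-assoc       = ≡-assoc
  mapUnits-resp f-cong (≡-scal p)    = ≡-scal (mapUnits-resp f-cong p)
  mapUnits-resp f-cong (≡-plus p q)  = ≡-plus (mapUnits-resp f-cong p) (mapUnits-resp f-cong q)
  mapUnits-resp f-cong (≡-arrow p q) = UnitCongruent.⇒-cong f-cong p q
  mapUnits-resp f-cong (≡-allu p)    = UnitCongruent.∀ᵤ-cong f-cong p
  mapUnits-resp f-cong (≡-allg p)    = UnitCongruent.∀ₘ-cong f-cong p

  headIndex : UType → ℕ
  headIndex (uvar x) = 0
  headIndex (U ⇒ T)  = 1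
  headIndex (∀ᵤ U)   = 2
  headIndex (∀ₘ U)   = 3

  -- Each unit summand is sent to the general variable named by its head constructor.
  headIndex-resp : ∀ {V V'} → ⌜ V ⌝ ≡ᵀ ⌜ V' ⌝ → headIndex V ≡ headIndex V'
  headIndex-resp = gvar-injective ∘ mapUnits-resp (record
    { ⇒-cong = λ _ _ → ≡-refl ; ∀ᵤ-cong = λ _ → ≡-refl ; ∀ₘ-cong = λ _ → ≡-refl })

  ∀ᵤ-injective : ∀ {U U'} → ⌜ ∀ᵤ U ⌝ ≡ᵀ ⌜ ∀ᵤ U' ⌝ → ⌜ U ⌝ ≡ᵀ ⌜ U' ⌝
  ∀ᵤ-injective = mapUnits-resp {strip} (record { ⇒-cong = ≡-arrow ; ∀ᵤ-cong = id ; ∀ₘ-cong = ≡-allg })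
    where
      strip : UType → Type
      strip (∀ᵤ U) = ⌜ U ⌝
      strip V      = ⌜ V ⌝

  ∀ₘ-injective : ∀ {U U'} → ⌜ ∀ₘ U ⌝ ≡ᵀ ⌜ ∀ₘ U' ⌝ → ⌜ U ⌝ ≡ᵀ ⌜ U' ⌝
  ∀ₘ-injective = mapUnits-resp {strip} (record { ⇒-cong = ≡-arrow ; ∀ᵤ-cong = ≡-allu ; ∀ₘ-cong = id })
    where
      strip : UType → Type
      strip (∀ₘ U) = ⌜ U ⌝
      strip V      = ⌜ V ⌝

  ⇒-injective : ∀ {U T U' T'} → ⌜ U ⇒ T ⌝ ≡ᵀ ⌜ U' ⇒ T' ⌝ → ⌜ U ⌝ ≡ᵀ ⌜ U' ⌝ × T ≡ᵀ T'
  ⇒-injective p =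
    mapUnits-resp {domain} (record { ⇒-cong = λ p _ → p ; ∀ᵤ-cong = ≡-allu ; ∀ₘ-cong = ≡-allg }) p ,
    mapUnits-resp {codomain} (record { ⇒-cong = λ _ q → q ; ∀ᵤ-cong = ≡-allu ; ∀ₘ-cong = ≡-allg }) p
    where
      domain codomain : UType → Type
      domain (U ⇒ T) = ⌜ U ⌝
      domain V       = ⌜ V ⌝
      codomain (U ⇒ T) = T
      codomain V       = ⌜ V ⌝

  ∀[_]-cong : ∀ k {U U'} → ⌜ U ⌝ ≡ᵀ ⌜ U' ⌝ → ⌜ ∀[ k ] U ⌝ ≡ᵀ ⌜ ∀[ k ] U' ⌝
  ∀[ unitK ]-cong = ≡-allu
  ∀[ genK  ]-cong = ≡-allg

  ∀⃗⇒-injective : ∀ ks ks' {U T U' T'} → ⌜ ∀⃗ ks (U ⇒ T) ⌝ ≡ᵀ ⌜ ∀⃗ ks' (U' ⇒ T') ⌝ →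
                  ks ≡ ks' × ⌜ U ⌝ ≡ᵀ ⌜ U' ⌝ × T ≡ᵀ T'
  ∀⃗⇒-injective []            []             p = refl , ⇒-injective p
  ∀⃗⇒-injective (unitK ∷ ks) (unitK ∷ ks') p with ∀⃗⇒-injective ks ks' (∀ᵤ-injective p)
  ... | refl , q = refl , q
  ∀⃗⇒-injective (genK ∷ ks)  (genK ∷ ks')  p with ∀⃗⇒-injective ks ks' (∀ₘ-injective p)
  ... | refl , q = refl , q
  ∀⃗⇒-injective []            (unitK ∷ _)   p = contradiction (headIndex-resp p) λ ()
  ∀⃗⇒-injective []            (genK ∷ _)    p = contradiction (headIndex-resp p) λ ()
  ∀⃗⇒-injective (unitK ∷ _)  []             p = contradiction (headIndex-resp p) λ ()
  ∀⃗⇒-injective (genK ∷ _)   []             p = contradiction (headIndex-resp p) λ ()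
  ∀⃗⇒-injective (unitK ∷ _)  (genK ∷ _)    p = contradiction (headIndex-resp p) λ ()
  ∀⃗⇒-injective (genK ∷ _)   (unitK ∷ _)   p = contradiction (headIndex-resp p) λ ()

  ∀[]≡ᵀ∀⃗⇒-inversion : ∀ k ks {U A B} → ⌜ ∀[ k ] U ⌝ ≡ᵀ ⌜ ∀⃗ ks (A ⇒ B) ⌝ →
                      Σ (List Kind) λ ks' → ks ≡ k ∷ ks' × ⌜ U ⌝ ≡ᵀ ⌜ ∀⃗ ks' (A ⇒ B) ⌝
  ∀[]≡ᵀ∀⃗⇒-inversion unitK (unitK ∷ ks) p = ks , refl , ∀ᵤ-injective p
  ∀[]≡ᵀ∀⃗⇒-inversion genK  (genK ∷ ks)  p = ks , refl , ∀ₘ-injective p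
  ∀[]≡ᵀ∀⃗⇒-inversion unitK []           p = contradiction (headIndex-resp p) λ ()
  ∀[]≡ᵀ∀⃗⇒-inversion genK  []           p = contradiction (headIndex-resp p) λ ()
  ∀[]≡ᵀ∀⃗⇒-inversion unitK (genK ∷ _)   p = contradiction (headIndex-resp p) λ ()
  ∀[]≡ᵀ∀⃗⇒-inversion genK  (unitK ∷ _)  p = contradiction (headIndex-resp p) λ ()

  AllUnits : {ℓ : Level} → (UType → Set ℓ) → Type → Set ℓ
  AllUnits P ⌜ U ⌝    = P U
  AllUnits P (α ·ᵀ T) = AllUnits P T
  AllUnits P (T +ᵀ R) = AllUnits P T × AllUnits P R
  AllUnits P (gvar x) = Poly.⊥

  AllUnits-resp : {ℓ : Level} {P : UType → Set ℓ} → (∀ {V V'} → ⌜ V ⌝ ≡ᵀ ⌜ V' ⌝ → P V → P V') →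
                  ∀ {T R} → T ≡ᵀ R → AllUnits P T ⇔ AllUnits P R
  AllUnits-resp P-resp ≡-refl        = ⇔.refl
  AllUnits-resp P-resp (≡-sym p)     = ⇔.sym (AllUnits-resp P-resp p)
  AllUnits-resp P-resp (≡-trans p q) = ⇔.trans (AllUnits-resp P-resp p) (AllUnits-resp P-resp q)
  AllUnits-resp P-resp ≡-one         = ⇔.refl
  AllUnits-resp P-resp ≡-mul         = ⇔.refl
  AllUnits-resp P-resp ≡-dist        = ⇔.refl
  AllUnits-resp P-resp ≡-fact        = mk⇔ proj₁ (λ p → p , p)
  AllUnits-resp P-resp ≡-comm        = mk⇔ Product.swap Product.swap
  AllUnits-resp P-resp ≡-assoc       = mk⇔ Product.assocˡ Product.assocʳ
  AllUnits-resp P-resp (≡-scal p)    = AllUnits-resp P-resp p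
  AllUnits-resp P-resp (≡-plus p q)  = AllUnits-resp P-resp p ×-⇔ AllUnits-resp P-resp q
  AllUnits-resp P-resp (≡-arrow p q) = mk⇔ (P-resp (≡-arrow p q)) (P-resp (≡-sym (≡-arrow p q)))
  AllUnits-resp P-resp (≡-allu p)    = mk⇔ (P-resp (≡-allu p)) (P-resp (≡-sym (≡-allu p)))
  AllUnits-resp P-resp (≡-allg p)    = mk⇔ (P-resp (≡-allg p)) (P-resp (≡-sym (≡-allg p)))

  AllUnits-⨁⁻ : {ℓ : Level} {P : UType → Set ℓ} (L : List⁺ A) (f : A → Type) →
                AllUnits P (⨁ L f) → All⁺.All (AllUnits P ∘ f) L
  AllUnits-⨁⁻ {P = P} (x ∷ xs) f = go x xs
    where
      go : ∀ x xs → AllUnits P (⨁∷ x xs f) → All⁺.All (AllUnits P ∘ f) (x ∷ xs)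
      go x []       px          = px All⁺.∷ []
      go x (y ∷ ys) (px , pxs) with go y ys pxs
      ... | py All⁺.∷ pys = px All⁺.∷ (py ∷ pys)

  AllUnits-⨁⁺ : {ℓ : Level} {P : UType → Set ℓ} (L : List⁺ A) (f : A → Type) →
                All⁺.All (AllUnits P ∘ f) L → AllUnits P (⨁ L f)
  AllUnits-⨁⁺ {P = P} (x ∷ xs) f (px All⁺.∷ pxs) = go x xs px pxs
    where
      go : ∀ x xs → AllUnits P (f x) → All (AllUnits P ∘ f) xs → AllUnits P (⨁∷ x xs f)
      go x []       px []         = px
      go x (y ∷ ys) px (py ∷ pys) = px , go y ys py pys

  AllUnits-sumU⁻ : {ℓ : Level} {P : UType → Set ℓ} (L : List⁺ (S × UType)) →
                   AllUnits P (sumU L) → All⁺.All (P ∘ proj₂) L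
  AllUnits-sumU⁻ {P = P} L = AllUnits-⨁⁻ L scaledU ∘ subst (AllUnits P) (sumU≡⨁ L)

  AllUnits-sumU⁺ : {ℓ : Level} {P : UType → Set ℓ} (L : List⁺ (S × UType)) →
                   All⁺.All (P ∘ proj₂) L → AllUnits P (sumU L)
  AllUnits-sumU⁺ {P = P} L = subst (AllUnits P) (sym (sumU≡⨁ L)) ∘ AllUnits-⨁⁺ L scaledU

  AllUnits-sumT⁺ : {ℓ : Level} {P : UType → Set ℓ} (L : List⁺ (S × Type)) →
                   All⁺.All (AllUnits P ∘ proj₂) L → AllUnits P (sumT L)
  AllUnits-sumT⁺ {P = P} L = subst (AllUnits P) (sym (sumT≡⨁ L)) ∘ AllUnits-⨁⁺ L scaled

  agree-zero-suc : {f g : ℕ → A} → f zero ≡ g zero → (∀ n → f (suc n) ≡ g (suc n)) → ∀ n → f n ≡ g n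
  agree-zero-suc z s zero    = z
  agree-zero-suc z s (suc n) = s n

  record _≗ᴱ_ (σ τ : Env) : Set c where
    constructor mk≗ᴱ
    field
      eu : ∀ n → Env.σu σ n ≡ Env.σu τ n
      eg : ∀ n → Env.σg σ n ≡ Env.σg τ n
  open _≗ᴱ_

  ≗ᴱ-refl : ∀ {σ} → σ ≗ᴱ σ
  ≗ᴱ-refl = mk≗ᴱ (λ _ → refl) (λ _ → refl)

  ≗ᴱ-sym : ∀ {σ τ} → σ ≗ᴱ τ → τ ≗ᴱ σ
  ≗ᴱ-sym e = mk≗ᴱ (sym ∘ eu e) (sym ∘ eg e)

  ≗ᴱ-trans : ∀ {σ τ υ} → σ ≗ᴱ τ → τ ≗ᴱ υ → σ ≗ᴱ υ
  ≗ᴱ-trans e f = mk≗ᴱ (λ n → trans (eu e n) (eu f n)) (λ n → trans (eg e n) (eg f n))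

  ext-cong : ∀ {ρ ρ'} → (∀ n → ρ n ≡ ρ' n) → ∀ n → ext ρ n ≡ ext ρ' n
  ext-cong e = agree-zero-suc refl (cong suc ∘ e)

  ext-∘ : ∀ ρ ρ' n → ext ρ (ext ρ' n) ≡ ext (ρ ∘ ρ') n
  ext-∘ ρ ρ' = agree-zero-suc refl (λ _ → refl)

  mutual
    renU-cong : ∀ {ρu ρu' ρg ρg'} → (∀ n → ρu n ≡ ρu' n) → (∀ n → ρg n ≡ ρg' n) →
                ∀ U → renU ρu ρg U ≡ renU ρu' ρg' U
    renU-cong eu eg (uvar x) = cong uvar (eu x)
    renU-cong eu eg (U ⇒ T)  = cong₂ _⇒_ (renU-cong eu eg U) (renT-cong eu eg T)
    renU-cong eu eg (∀ᵤ U)   = cong ∀ᵤ_ (renU-cong (ext-cong eu) eg U)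
    renU-cong eu eg (∀ₘ U)   = cong ∀ₘ_ (renU-cong eu (ext-cong eg) U)

    renT-cong : ∀ {ρu ρu' ρg ρg'} → (∀ n → ρu n ≡ ρu' n) → (∀ n → ρg n ≡ ρg' n) →
                ∀ T → renT ρu ρg T ≡ renT ρu' ρg' T
    renT-cong eu eg ⌜ U ⌝    = cong ⌜_⌝ (renU-cong eu eg U)
    renT-cong eu eg (α ·ᵀ T) = cong (α ·ᵀ_) (renT-cong eu eg T)
    renT-cong eu eg (T +ᵀ R) = cong₂ _+ᵀ_ (renT-cong eu eg T) (renT-cong eu eg R)
    renT-cong eu eg (gvar x) = cong gvar (eg x)

  liftᵤ-cong : ∀ {σ τ} → σ ≗ᴱ τ → liftᵤ σ ≗ᴱ liftᵤ τ
  liftᵤ-cong e = mk≗ᴱ (agree-zero-suc refl (cong (renU suc id) ∘ eu e)) (cong (renT suc id) ∘ eg e)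

  liftₘ-cong : ∀ {σ τ} → σ ≗ᴱ τ → liftₘ σ ≗ᴱ liftₘ τ
  liftₘ-cong e = mk≗ᴱ (cong (renU id suc) ∘ eu e) (agree-zero-suc refl (cong (renT id suc) ∘ eg e))

  mutual
    substU-cong : ∀ {σ τ} → σ ≗ᴱ τ → ∀ U → substU σ U ≡ substU τ U
    substU-cong e (uvar x) = eu e x
    substU-cong e (U ⇒ T)  = cong₂ _⇒_ (substU-cong e U) (substT-cong e T)
    substU-cong e (∀ᵤ U)   = cong ∀ᵤ_ (substU-cong (liftᵤ-cong e) U)
    substU-cong e (∀ₘ U)   = cong ∀ₘ_ (substU-cong (liftₘ-cong e) U)

    substT-cong : ∀ {σ τ} → σ ≗ᴱ τ → ∀ T → substT σ T ≡ substT τ T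
    substT-cong e ⌜ U ⌝    = cong ⌜_⌝ (substU-cong e U)
    substT-cong e (α ·ᵀ T) = cong (α ·ᵀ_) (substT-cong e T)
    substT-cong e (T +ᵀ R) = cong₂ _+ᵀ_ (substT-cong e T) (substT-cong e R)
    substT-cong e (gvar x) = eg e x

  mutual
    renU-renU : ∀ ρu ρg ρu' ρg' U → renU ρu ρg (renU ρu' ρg' U) ≡ renU (ρu ∘ ρu') (ρg ∘ ρg') U
    renU-renU ρu ρg ρu' ρg' (uvar x) = refl
    renU-renU ρu ρg ρu' ρg' (U ⇒ T)  = cong₂ _⇒_ (renU-renU ρu ρg ρu' ρg' U) (renT-renT ρu ρg ρu' ρg' T)
    renU-renU ρu ρg ρu' ρg' (∀ᵤ U)   = cong ∀ᵤ_ (trans (renU-renU (ext ρu) ρg (ext ρu') ρg' U)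
                                                       (renU-cong (ext-∘ ρu ρu') (λ _ → refl) U))
    renU-renU ρu ρg ρu' ρg' (∀ₘ U)   = cong ∀ₘ_ (trans (renU-renU ρu (ext ρg) ρu' (ext ρg') U)
                                                       (renU-cong (λ _ → refl) (ext-∘ ρg ρg') U))

    renT-renT : ∀ ρu ρg ρu' ρg' T → renT ρu ρg (renT ρu' ρg' T) ≡ renT (ρu ∘ ρu') (ρg ∘ ρg') T
    renT-renT ρu ρg ρu' ρg' ⌜ U ⌝    = cong ⌜_⌝ (renU-renU ρu ρg ρu' ρg' U)
    renT-renT ρu ρg ρu' ρg' (α ·ᵀ T) = cong (α ·ᵀ_) (renT-renT ρu ρg ρu' ρg' T)
    renT-renT ρu ρg ρu' ρg' (T +ᵀ R) = cong₂ _+ᵀ_ (renT-renT ρu ρg ρu' ρg' T) (renT-renT ρu ρg ρu' ρg' R)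
    renT-renT ρu ρg ρu' ρg' (gvar x) = refl

  _⊙ʳ_ : Env → (ℕ → ℕ) × (ℕ → ℕ) → Env
  σ ⊙ʳ (ρu , ρg) = env (Env.σu σ ∘ ρu) (Env.σg σ ∘ ρg)

  mutual
    substU-renU : ∀ σ ρu ρg U → substU σ (renU ρu ρg U) ≡ substU (σ ⊙ʳ (ρu , ρg)) U
    substU-renU σ ρu ρg (uvar x) = refl
    substU-renU σ ρu ρg (U ⇒ T)  = cong₂ _⇒_ (substU-renU σ ρu ρg U) (substT-renT σ ρu ρg T)
    substU-renU σ ρu ρg (∀ᵤ U)   = cong ∀ᵤ_ (trans (substU-renU (liftᵤ σ) (ext ρu) ρg U)
      (substU-cong (mk≗ᴱ (agree-zero-suc refl (λ _ → refl)) (λ _ → refl)) U))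
    substU-renU σ ρu ρg (∀ₘ U)   = cong ∀ₘ_ (trans (substU-renU (liftₘ σ) ρu (ext ρg) U)
      (substU-cong (mk≗ᴱ (λ _ → refl) (agree-zero-suc refl (λ _ → refl))) U))

    substT-renT : ∀ σ ρu ρg T → substT σ (renT ρu ρg T) ≡ substT (σ ⊙ʳ (ρu , ρg)) T
    substT-renT σ ρu ρg ⌜ U ⌝    = cong ⌜_⌝ (substU-renU σ ρu ρg U)
    substT-renT σ ρu ρg (α ·ᵀ T) = cong (α ·ᵀ_) (substT-renT σ ρu ρg T)
    substT-renT σ ρu ρg (T +ᵀ R) = cong₂ _+ᵀ_ (substT-renT σ ρu ρg T) (substT-renT σ ρu ρg R)
    substT-renT σ ρu ρg (gvar x) = refl

  _ʳ⊙_ : (ℕ → ℕ) × (ℕ → ℕ) → Env → Env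
  (ρu , ρg) ʳ⊙ σ = env (renU ρu ρg ∘ Env.σu σ) (renT ρu ρg ∘ Env.σg σ)

  mutual
    renU-substU : ∀ ρu ρg σ U → renU ρu ρg (substU σ U) ≡ substU ((ρu , ρg) ʳ⊙ σ) U
    renU-substU ρu ρg σ (uvar x) = refl
    renU-substU ρu ρg σ (U ⇒ T)  = cong₂ _⇒_ (renU-substU ρu ρg σ U) (renT-substT ρu ρg σ T)
    renU-substU ρu ρg σ (∀ᵤ U)   = cong ∀ᵤ_ (trans (renU-substU (ext ρu) ρg (liftᵤ σ) U)
      (substU-cong (mk≗ᴱ
        (agree-zero-suc refl λ n → trans (renU-renU (ext ρu) ρg suc id (Env.σu σ n))
                                         (sym (renU-renU suc id ρu ρg (Env.σu σ n))))
        (λ n → trans (renT-renT (ext ρu) ρg suc id (Env.σg σ n))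
                     (sym (renT-renT suc id ρu ρg (Env.σg σ n))))) U))
    renU-substU ρu ρg σ (∀ₘ U)   = cong ∀ₘ_ (trans (renU-substU ρu (ext ρg) (liftₘ σ) U)
      (substU-cong (mk≗ᴱ
        (λ n → trans (renU-renU ρu (ext ρg) id suc (Env.σu σ n)) (sym (renU-renU id suc ρu ρg (Env.σu σ n))))
        (agree-zero-suc refl λ n → trans (renT-renT ρu (ext ρg) id suc (Env.σg σ n))
                                         (sym (renT-renT id suc ρu ρg (Env.σg σ n))))) U))

    renT-substT : ∀ ρu ρg σ T → renT ρu ρg (substT σ T) ≡ substT ((ρu , ρg) ʳ⊙ σ) T
    renT-substT ρu ρg σ ⌜ U ⌝    = cong ⌜_⌝ (renU-substU ρu ρg σ U)
    renT-substT ρu ρg σ (α ·ᵀ T) = cong (α ·ᵀ_) (renT-substT ρu ρg σ T)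
    renT-substT ρu ρg σ (T +ᵀ R) = cong₂ _+ᵀ_ (renT-substT ρu ρg σ T) (renT-substT ρu ρg σ R)
    renT-substT ρu ρg σ (gvar x) = refl

  _⊙_ : Env → Env → Env
  σ ⊙ τ = env (substU σ ∘ Env.σu τ) (substT σ ∘ Env.σg τ)

  mutual
    substU-substU : ∀ σ τ U → substU σ (substU τ U) ≡ substU (σ ⊙ τ) U
    substU-substU σ τ (uvar x) = refl
    substU-substU σ τ (U ⇒ T)  = cong₂ _⇒_ (substU-substU σ τ U) (substT-substT σ τ T)
    substU-substU σ τ (∀ᵤ U)   = cong ∀ᵤ_ (trans (substU-substU (liftᵤ σ) (liftᵤ τ) U)
      (substU-cong (mk≗ᴱ
        (agree-zero-suc refl λ n → trans (substU-renU (liftᵤ σ) suc id (Env.σu τ n))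
                                         (sym (renU-substU suc id σ (Env.σu τ n))))
        (λ n → trans (substT-renT (liftᵤ σ) suc id (Env.σg τ n)) (sym (renT-substT suc id σ (Env.σg τ n))))) U))
    substU-substU σ τ (∀ₘ U)   = cong ∀ₘ_ (trans (substU-substU (liftₘ σ) (liftₘ τ) U)
      (substU-cong (mk≗ᴱ
        (λ n → trans (substU-renU (liftₘ σ) id suc (Env.σu τ n)) (sym (renU-substU id suc σ (Env.σu τ n))))
        (agree-zero-suc refl λ n → trans (substT-renT (liftₘ σ) id suc (Env.σg τ n))
                                         (sym (renT-substT id suc σ (Env.σg τ n))))) U))

    substT-substT : ∀ σ τ T → substT σ (substT τ T) ≡ substT (σ ⊙ τ) T
    substT-substT σ τ ⌜ U ⌝    = cong ⌜_⌝ (substU-substU σ τ U)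
    substT-substT σ τ (α ·ᵀ T) = cong (α ·ᵀ_) (substT-substT σ τ T)
    substT-substT σ τ (T +ᵀ R) = cong₂ _+ᵀ_ (substT-substT σ τ T) (substT-substT σ τ R)
    substT-substT σ τ (gvar x) = refl

  mutual
    substU-id : ∀ U → substU idEnv U ≡ U
    substU-id (uvar x) = refl
    substU-id (U ⇒ T)  = cong₂ _⇒_ (substU-id U) (substT-id T)
    substU-id (∀ᵤ U)   = cong ∀ᵤ_ (trans (substU-cong (mk≗ᴱ (agree-zero-suc refl (λ _ → refl)) (λ _ → refl)) U)
                                         (substU-id U))
    substU-id (∀ₘ U)   = cong ∀ₘ_ (trans (substU-cong (mk≗ᴱ (λ _ → refl) (agree-zero-suc refl (λ _ → refl))) U)
                                         (substU-id U))

    substT-id : ∀ T → substT idEnv T ≡ T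
    substT-id ⌜ U ⌝    = cong ⌜_⌝ (substU-id U)
    substT-id (α ·ᵀ T) = cong (α ·ᵀ_) (substT-id T)
    substT-id (T +ᵀ R) = cong₂ _+ᵀ_ (substT-id T) (substT-id R)
    substT-id (gvar x) = refl

  idEnv-⊙ : ∀ σ → (idEnv ⊙ σ) ≗ᴱ σ
  idEnv-⊙ σ = mk≗ᴱ (λ n → substU-id _) (λ n → substT-id _)

  wkT : Kind → Type → Type
  wkT unitK = renT suc id
  wkT genK  = renT id suc

  wkArg : Kind → ∀ {k} → Arg k → Arg k
  wkArg k' {unitK} A = wk k' A
  wkArg k' {genK}  A = wkT k' A

  wkAll : Kind → ∀ {ks} → All Arg ks → All Arg ks
  wkAll k' []       = []
  wkAll k' (A ∷ As) = wkArg k' A ∷ wkAll k' As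

  substArg : Env → ∀ {k} → Arg k → Arg k
  substArg σ {unitK} A = substU σ A
  substArg σ {genK}  A = substT σ A

  substAll : Env → ∀ {ks} → All Arg ks → All Arg ks
  substAll σ []       = []
  substAll σ (A ∷ As) = substArg σ A ∷ substAll σ As

  liftK : Kind → Env → Env
  liftK unitK = liftᵤ
  liftK genK  = liftₘ

  liftKs : List Kind → Env → Env
  liftKs []       σ = σ
  liftKs (k ∷ ks) σ = liftKs ks (liftK k σ)

  substU-∀[] : ∀ σ k U → substU σ (∀[ k ] U) ≡ ∀[ k ] substU (liftK k σ) U
  substU-∀[] σ unitK U = refl
  substU-∀[] σ genK  U = refl

  substU-∀⃗ : ∀ σ ks U → substU σ (∀⃗ ks U) ≡ ∀⃗ ks (substU (liftKs ks σ) U)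
  substU-∀⃗ σ []       U = refl
  substU-∀⃗ σ (k ∷ ks) U = trans (substU-∀[] σ k (∀⃗ ks U)) (cong ∀[ k ]_ (substU-∀⃗ (liftK k σ) ks U))

  wkRen : Kind → (ℕ → ℕ) × (ℕ → ℕ)
  wkRen unitK = suc , id
  wkRen genK  = id , suc

  wk≡renU : ∀ k U → wk k U ≡ renU (proj₁ (wkRen k)) (proj₂ (wkRen k)) U
  wk≡renU unitK U = refl
  wk≡renU genK  U = refl

  wkT≡renT : ∀ k T → wkT k T ≡ renT (proj₁ (wkRen k)) (proj₂ (wkRen k)) T
  wkT≡renT unitK T = refl
  wkT≡renT genK  T = refl

  liftK-⊙ʳ-wkRen : ∀ k σ → (liftK k σ ⊙ʳ wkRen k) ≗ᴱ (wkRen k ʳ⊙ σ)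
  liftK-⊙ʳ-wkRen unitK σ = ≗ᴱ-refl
  liftK-⊙ʳ-wkRen genK  σ = ≗ᴱ-refl

  liftK-wk : ∀ k σ U → substU (liftK k σ) (wk k U) ≡ wk k (substU σ U)
  liftK-wk k σ U = begin
    substU (liftK k σ) (wk k U)                           ≡⟨ cong (substU (liftK k σ)) (wk≡renU k U) ⟩
    substU (liftK k σ) (renU _ _ U)                       ≡⟨ substU-renU (liftK k σ) _ _ U ⟩
    substU (liftK k σ ⊙ʳ wkRen k) U                       ≡⟨ substU-cong (liftK-⊙ʳ-wkRen k σ) U ⟩
    substU (wkRen k ʳ⊙ σ) U                               ≡⟨ renU-substU _ _ σ U ⟨
    renU (proj₁ (wkRen k)) (proj₂ (wkRen k)) (substU σ U) ≡⟨ wk≡renU k _ ⟨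
    wk k (substU σ U)                                     ∎
    where open P.≡-Reasoning

  extend-⊙ʳ-wkRen : ∀ k (A : Arg k) τ → (extend k A τ ⊙ʳ wkRen k) ≗ᴱ τ
  extend-⊙ʳ-wkRen unitK A τ = ≗ᴱ-refl
  extend-⊙ʳ-wkRen genK  A τ = ≗ᴱ-refl

  extend-wk : ∀ k (A : Arg k) τ U → substU (extend k A τ) (wk k U) ≡ substU τ U
  extend-wk k A τ U = trans (cong (substU (extend k A τ)) (wk≡renU k U))
    (trans (substU-renU (extend k A τ) _ _ U) (substU-cong (extend-⊙ʳ-wkRen k A τ) U))

  extend-wkT : ∀ k (A : Arg k) τ T → substT (extend k A τ) (wkT k T) ≡ substT τ T
  extend-wkT k A τ T = trans (cong (substT (extend k A τ)) (wkT≡renT k T))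
    (trans (substT-renT (extend k A τ) _ _ T) (substT-cong (extend-⊙ʳ-wkRen k A τ) T))

  instantiate-wk : ∀ k (A : Arg k) U → substU (extend k A idEnv) (wk k U) ≡ U
  instantiate-wk k A U = trans (extend-wk k A idEnv U) (substU-id U)

  instantiate-wkArg : ∀ k (A : Arg k) k' (B : Arg k') → substArg (extend k A idEnv) (wkArg k B) ≡ B
  instantiate-wkArg k A unitK B = instantiate-wk k A B
  instantiate-wkArg k A genK  B = trans (extend-wkT k A idEnv B) (substT-id B)

  extend-cong : ∀ k (A : Arg k) {σ τ} → σ ≗ᴱ τ → extend k A σ ≗ᴱ extend k A τ
  extend-cong unitK A e = mk≗ᴱ (agree-zero-suc refl (eu e)) (eg e)
  extend-cong genK  A e = mk≗ᴱ (eu e) (agree-zero-suc refl (eg e))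

  envOf-cong : ∀ ks (As : All Arg ks) {σ τ} → σ ≗ᴱ τ → envOf ks As σ ≗ᴱ envOf ks As τ
  envOf-cong []       []       e = e
  envOf-cong (k ∷ ks) (A ∷ As) e = envOf-cong ks As (extend-cong k A e)

  ⊙-extend-commute : ∀ k (A : Arg k) σ τ τ' σ' → (σ ⊙ τ) ≗ᴱ (τ' ⊙ σ') →
                     (σ ⊙ extend k A τ) ≗ᴱ (extend k (substArg σ A) τ' ⊙ liftK k σ')
  ⊙-extend-commute unitK A σ τ τ' σ' h = mk≗ᴱ
    (agree-zero-suc refl λ n → trans (eu h n) (sym (extend-wk unitK (substU σ A) τ' (Env.σu σ' n))))
    (λ n → trans (eg h n) (sym (extend-wkT unitK (substU σ A) τ' (Env.σg σ' n))))
  ⊙-extend-commute genK A σ τ τ' σ' h = mk≗ᴱ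
    (λ n → trans (eu h n) (sym (extend-wk genK (substT σ A) τ' (Env.σu σ' n))))
    (agree-zero-suc refl λ n → trans (eg h n) (sym (extend-wkT genK (substT σ A) τ' (Env.σg σ' n))))

  ⊙-envOf-commute : ∀ ks (As : All Arg ks) σ τ τ' σ' → (σ ⊙ τ) ≗ᴱ (τ' ⊙ σ') →
                    (σ ⊙ envOf ks As τ) ≗ᴱ (envOf ks (substAll σ As) τ' ⊙ liftKs ks σ')
  ⊙-envOf-commute []       []       σ τ τ' σ' h = h
  ⊙-envOf-commute (k ∷ ks) (A ∷ As) σ τ τ' σ' h =
    ⊙-envOf-commute ks As σ _ _ _ (⊙-extend-commute k A σ τ τ' σ' h)

  substU-substsU : ∀ σ ks As U →
                   substU σ (substsU ks As U) ≡ substsU ks (substAll σ As) (substU (liftKs ks σ) U)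
  substU-substsU σ ks As U = trans (substU-substU σ _ U)
    (trans (substU-cong (⊙-envOf-commute ks As σ idEnv idEnv σ (≗ᴱ-sym (idEnv-⊙ σ))) U)
           (sym (substU-substU _ _ U)))

  substT-substsT : ∀ σ ks As T →
                   substT σ (substsT ks As T) ≡ substsT ks (substAll σ As) (substT (liftKs ks σ) T)
  substT-substsT σ ks As T = trans (substT-substT σ _ T)
    (trans (substT-cong (⊙-envOf-commute ks As σ idEnv idEnv σ (≗ᴱ-sym (idEnv-⊙ σ))) T)
           (sym (substT-substT _ _ T)))

  substU-[/]U : ∀ σ k (A : Arg k) U → substU σ (U [ A /]U) ≡ substU (liftK k σ) U [ substArg σ A /]U
  substU-[/]U σ k A U = substU-substsU σ (k ∷ []) (A ∷ []) U

  extend-⊙-liftK : ∀ k (A : Arg k) τ σ → (extend k A τ ⊙ liftK k σ) ≗ᴱ extend k A (τ ⊙ σ)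
  extend-⊙-liftK unitK A τ σ = mk≗ᴱ
    (agree-zero-suc refl λ n → extend-wk unitK A τ (Env.σu σ n)) (λ n → extend-wkT unitK A τ (Env.σg σ n))
  extend-⊙-liftK genK A τ σ = mk≗ᴱ
    (λ n → extend-wk genK A τ (Env.σu σ n)) (agree-zero-suc refl λ n → extend-wkT genK A τ (Env.σg σ n))

  envOf-⊙-liftKs : ∀ ks (As : All Arg ks) τ σ → (envOf ks As τ ⊙ liftKs ks σ) ≗ᴱ envOf ks As (τ ⊙ σ)
  envOf-⊙-liftKs []       []       τ σ = ≗ᴱ-refl
  envOf-⊙-liftKs (k ∷ ks) (A ∷ As) τ σ =
    ≗ᴱ-trans (envOf-⊙-liftKs ks As (extend k A τ) (liftK k σ)) (envOf-cong ks As (extend-⊙-liftK k A τ σ))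

  substsU-liftKs : ∀ k (A : Arg k) ks As U →
                   substsU ks As (substU (liftKs ks (extend k A idEnv)) U) ≡ substsU (k ∷ ks) (A ∷ As) U
  substsU-liftKs k A ks As U = trans (substU-substU _ _ U)
    (substU-cong (≗ᴱ-trans (envOf-⊙-liftKs ks As idEnv _) (envOf-cong ks As (idEnv-⊙ _))) U)

  substsT-liftKs : ∀ k (A : Arg k) ks As T →
                   substsT ks As (substT (liftKs ks (extend k A idEnv)) T) ≡ substsT (k ∷ ks) (A ∷ As) T
  substsT-liftKs k A ks As T = trans (substT-substT _ _ T)
    (substT-cong (≗ᴱ-trans (envOf-⊙-liftKs ks As idEnv _) (envOf-cong ks As (idEnv-⊙ _))) T)

  ⊙-extend-wkArg : ∀ σ k' → (∀ {k} (B : Arg k) → substArg σ (wkArg k' B) ≡ B) →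
                   ∀ τ k (B : Arg k) → (σ ⊙ extend k (wkArg k' B) τ) ≗ᴱ extend k B (σ ⊙ τ)
  ⊙-extend-wkArg σ k' σ-wk τ unitK B = mk≗ᴱ (agree-zero-suc (σ-wk B) (λ _ → refl)) (λ _ → refl)
  ⊙-extend-wkArg σ k' σ-wk τ genK  B = mk≗ᴱ (λ _ → refl) (agree-zero-suc (σ-wk B) (λ _ → refl))

  ⊙-envOf-wkAll : ∀ σ k' → (∀ {k} (B : Arg k) → substArg σ (wkArg k' B) ≡ B) →
                  ∀ ks (As : All Arg ks) τ → (σ ⊙ envOf ks (wkAll k' As) τ) ≗ᴱ envOf ks As (σ ⊙ τ)
  ⊙-envOf-wkAll σ k' σ-wk []       []       τ = ≗ᴱ-refl
  ⊙-envOf-wkAll σ k' σ-wk (k ∷ ks) (B ∷ As) τ =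
    ≗ᴱ-trans (⊙-envOf-wkAll σ k' σ-wk ks As _) (envOf-cong ks As (⊙-extend-wkArg σ k' σ-wk τ k B))

  instantiate-substsU-wkAll : ∀ k (A : Arg k) ks As U →
    substU (extend k A idEnv) (substsU ks (wkAll k As) U) ≡ substsU (k ∷ ks) (A ∷ As) U
  instantiate-substsU-wkAll k A ks As U = trans (substU-substU _ _ U)
    (substU-cong (⊙-envOf-wkAll (extend k A idEnv) k (instantiate-wkArg k A _) ks As idEnv) U)

  instantiate-substsT-wkAll : ∀ k (A : Arg k) ks As T →
    substT (extend k A idEnv) (substsT ks (wkAll k As) T) ≡ substsT (k ∷ ks) (A ∷ As) T
  instantiate-substsT-wkAll k A ks As T = trans (substT-substT _ _ T)
    (substT-cong (⊙-envOf-wkAll (extend k A idEnv) k (instantiate-wkArg k A _) ks As idEnv) T)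

  substT-resp : ∀ σ {T R} → T ≡ᵀ R → substT σ T ≡ᵀ substT σ R
  substT-resp σ ≡-refl        = ≡-refl
  substT-resp σ (≡-sym p)     = ≡-sym (substT-resp σ p)
  substT-resp σ (≡-trans p q) = ≡-trans (substT-resp σ p) (substT-resp σ q)
  substT-resp σ ≡-one         = ≡-one
  substT-resp σ ≡-mul         = ≡-mul
  substT-resp σ ≡-dist        = ≡-dist
  substT-resp σ ≡-fact        = ≡-fact
  substT-resp σ ≡-comm        = ≡-comm
  substT-resp σ ≡-assoc       = ≡-assoc
  substT-resp σ (≡-scal p)    = ≡-scal (substT-resp σ p)
  substT-resp σ (≡-plus p q)  = ≡-plus (substT-resp σ p) (substT-resp σ q)
  substT-resp σ (≡-arrow p q) = ≡-arrow (substT-resp σ p) (substT-resp σ q)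
  substT-resp σ (≡-allu p)    = ≡-allu (substT-resp (liftᵤ σ) p)
  substT-resp σ (≡-allg p)    = ≡-allg (substT-resp (liftₘ σ) p)

  renEnv : (ℕ → ℕ) → (ℕ → ℕ) → Env
  renEnv ρu ρg = env (uvar ∘ ρu) (gvar ∘ ρg)

  mutual
    substU-renEnv : ∀ ρu ρg U → substU (renEnv ρu ρg) U ≡ renU ρu ρg U
    substU-renEnv ρu ρg (uvar x) = refl
    substU-renEnv ρu ρg (U ⇒ T)  = cong₂ _⇒_ (substU-renEnv ρu ρg U) (substT-renEnv ρu ρg T)
    substU-renEnv ρu ρg (∀ᵤ U)   = cong ∀ᵤ_ (trans
      (substU-cong (mk≗ᴱ (agree-zero-suc refl (λ _ → refl)) (λ _ → refl)) U) (substU-renEnv (ext ρu) ρg U))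
    substU-renEnv ρu ρg (∀ₘ U)   = cong ∀ₘ_ (trans
      (substU-cong (mk≗ᴱ (λ _ → refl) (agree-zero-suc refl (λ _ → refl))) U) (substU-renEnv ρu (ext ρg) U))

    substT-renEnv : ∀ ρu ρg T → substT (renEnv ρu ρg) T ≡ renT ρu ρg T
    substT-renEnv ρu ρg ⌜ U ⌝    = cong ⌜_⌝ (substU-renEnv ρu ρg U)
    substT-renEnv ρu ρg (α ·ᵀ T) = cong (α ·ᵀ_) (substT-renEnv ρu ρg T)
    substT-renEnv ρu ρg (T +ᵀ R) = cong₂ _+ᵀ_ (substT-renEnv ρu ρg T) (substT-renEnv ρu ρg R)
    substT-renEnv ρu ρg (gvar x) = refl

  wkEnv : Kind → Env
  wkEnv k = renEnv (proj₁ (wkRen k)) (proj₂ (wkRen k))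

  substU-wkEnv : ∀ k U → substU (wkEnv k) U ≡ wk k U
  substU-wkEnv k U = trans (substU-renEnv _ _ U) (sym (wk≡renU k U))

  wk-resp : ∀ k {U U'} → ⌜ U ⌝ ≡ᵀ ⌜ U' ⌝ → ⌜ wk k U ⌝ ≡ᵀ ⌜ wk k U' ⌝
  wk-resp k {U} {U'} p =
    P.subst₂ _≡ᵀ_ (cong ⌜_⌝ (substU-wkEnv k U)) (cong ⌜_⌝ (substU-wkEnv k U')) (substT-resp (wkEnv k) p)

  substT-⨁ : ∀ σ (L : List⁺ A) (f : A → Type) → substT σ (⨁ L f) ≡ ⨁ L (substT σ ∘ f)
  substT-⨁ σ = ⨁-homo≡ (substT σ) (λ _ _ → refl)

  substT-sumU : ∀ σ (L : List⁺ (S × UType)) →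
                substT σ (sumU L) ≡ sumU (L⁺.map (λ (α , U) → α , substU σ U) L)
  substT-sumU σ L = trans (cong (substT σ) (sumU≡⨁ L))
    (trans (substT-⨁ σ L scaledU) (sym (sumU-map L proj₁ (substU σ ∘ proj₂))))

  arrowSum≡⨁ : ∀ ks U αTs → arrowSum ks U αTs ≡ ⨁ αTs (λ (α , T) → α ·ᵀ ⌜ ∀⃗ ks (U ⇒ T) ⌝)
  arrowSum≡⨁ ks U αTs = sumU-map αTs proj₁ _

  argSum≡⨁ : ∀ ks U βAs → argSum ks U βAs ≡ ⨁ βAs (λ (β , As) → β ·ᵀ ⌜ substsU ks As U ⌝)
  argSum≡⨁ ks U βAs = sumU-map βAs proj₁ _

  resSum≡ᵀ⨁⨁ : ∀ ks αTs βAs →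
    resSum ks αTs βAs ≡ᵀ ⨁ αTs (λ (α , T) → α ·ᵀ ⨁ βAs (λ (β , As) → β ·ᵀ substsT ks As T))
  resSum≡ᵀ⨁⨁ ks αTs βAs = begin
    resSum ks αTs βAs                                             ≡⟨ sumT≡⨁ _ ⟩
    ⨁ (concatMap row αTs) scaled                                  ≈⟨ ⨁-concatMap αTs row scaled ⟩
    ⨁ αTs (λ p → ⨁ (row p) scaled)                                ≡⟨ ⨁-cong≡ αTs (λ p → ⨁-map βAs _ scaled) ⟩
    ⨁ αTs (λ (α , T) → ⨁ βAs (λ (β , As) → (α ×ₛ β) ·ᵀ substsT ks As T))
      ≈⟨ ⨁-cong αTs (λ (α , T) → ≡-trans (⨁-cong βAs (λ _ → ≡-sym ≡-mul))
                                          (≡-sym (·ᵀ-distrib-⨁ α βAs _))) ⟩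
    ⨁ αTs (λ (α , T) → α ·ᵀ ⨁ βAs (λ (β , As) → β ·ᵀ substsT ks As T)) ∎
    where
      open ≡ᵀ-Reasoning
      row : S × Type → List⁺ (S × Type)
      row (α , T) = L⁺.map (λ (β , As) → (α ×ₛ β) , substsT ks As T) βAs

  quantify : Kind → S × UType → S × UType
  quantify k (α , U) = α , ∀[ k ] U

  instantiate : (k : Kind) → Arg k → S × UType → S × UType
  instantiate k A (α , U) = α , U [ A /]U

  substT-sumU-map : ∀ σ (L : List⁺ A) {f : A → S × UType} {g : B → S × UType} {h : A → B} →
                    (∀ x → map₂ (substU σ) (f x) ≡ g (h x)) →
                    substT σ (sumU (L⁺.map f L)) ≡ sumU (L⁺.map g (L⁺.map h L))
  substT-sumU-map σ L fgh = trans (substT-sumU σ _)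
    (cong sumU (trans (sym (L⁺ₚ.map-∘ L)) (trans (L⁺ₚ.map-cong fgh L) (L⁺ₚ.map-∘ L))))

  substT-arrowSum : ∀ σ ks U αTs → substT σ (arrowSum ks U αTs) ≡
                    arrowSum ks (substU (liftKs ks σ) U) (L⁺.map (map₂ (substT (liftKs ks σ))) αTs)
  substT-arrowSum σ ks U αTs = substT-sumU-map σ αTs λ (α , T) → cong (α ,_) (substU-∀⃗ σ ks (U ⇒ T))

  substT-argSum : ∀ σ ks U βAs → substT σ (argSum ks U βAs) ≡
                  argSum ks (substU (liftKs ks σ) U) (L⁺.map (map₂ (substAll σ)) βAs)
  substT-argSum σ ks U βAs = substT-sumU-map σ βAs λ (β , As) → cong (β ,_) (substU-substsU σ ks As U)

  substT-resSum : ∀ σ ks αTs βAs → substT σ (resSum ks αTs βAs) ≡ᵀ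
                  resSum ks (L⁺.map (map₂ (substT (liftKs ks σ))) αTs) (L⁺.map (map₂ (substAll σ)) βAs)
  substT-resSum σ ks αTs βAs = begin
    substT σ (resSum ks αTs βAs)
      ≈⟨ substT-resp σ (resSum≡ᵀ⨁⨁ ks αTs βAs) ⟩
    substT σ (⨁ αTs (λ (α , T) → α ·ᵀ ⨁ βAs (λ (β , As) → β ·ᵀ substsT ks As T)))
      ≡⟨ trans (substT-⨁ σ αTs _) (⨁-cong≡ αTs λ (α , T) → cong (α ·ᵀ_) (trans (substT-⨁ σ βAs _)
                (⨁-cong≡ βAs λ (β , As) → cong (β ·ᵀ_) (substT-substsT σ ks As T)))) ⟩
    ⨁ αTs (λ (α , T) → α ·ᵀ ⨁ βAs (λ (β , As) → β ·ᵀ substsT ks (substAll σ As) (substT σ' T)))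
      ≡⟨ trans (⨁-map αTs _ _) (⨁-cong≡ αTs λ (α , T) → cong (α ·ᵀ_) (⨁-map βAs _ _)) ⟨
    ⨁ αTs' (λ (α , T) → α ·ᵀ ⨁ βAs' (λ (β , As) → β ·ᵀ substsT ks As T))
      ≈⟨ resSum≡ᵀ⨁⨁ ks αTs' βAs' ⟨
    resSum ks αTs' βAs' ∎
    where
      open ≡ᵀ-Reasoning
      σ' = liftKs ks σ
      αTs' = L⁺.map (map₂ (substT σ')) αTs
      βAs' = L⁺.map (map₂ (substAll σ)) βAs

  substT-sumU-quantify : ∀ σ k L → substT σ (sumU (L⁺.map (quantify k) L)) ≡
                         sumU (L⁺.map (quantify k) (L⁺.map (map₂ (substU (liftK k σ))) L))
  substT-sumU-quantify σ k L = substT-sumU-map σ L λ (α , U) → cong (α ,_) (substU-∀[] σ k U)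

  substT-sumU-instantiate : ∀ σ k (A : Arg k) L → substT σ (sumU (L⁺.map (instantiate k A) L)) ≡
                            sumU (L⁺.map (instantiate k (substArg σ A)) (L⁺.map (map₂ (substU (liftK k σ))) L))
  substT-sumU-instantiate σ k A L = substT-sumU-map σ L λ (α , U) → cong (α ,_) (substU-[/]U σ k A U)

  ⊢-cast : ∀ {Γ t T T'} → T ≡ T' → Γ ⊢ t ∶ T → Γ ⊢ t ∶ T'
  ⊢-cast refl d = d

  ⊢-cast-scalar : ∀ {Γ α β t T} → α ≡ β → Γ ⊢ α • t ∶ T → Γ ⊢ β • t ∶ T
  ⊢-cast-scalar refl d = d

  ⊢-cast-ctx : ∀ {Γ Δ t T} → Γ ≡ Δ → Γ ⊢ t ∶ T → Δ ⊢ t ∶ T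
  ⊢-cast-ctx refl d = d

  ⊢-conv : ∀ {Γ t T T'} → Γ ⊢ t ∶ T → T ≡ᵀ T' → Γ ⊢ t ∶ T'
  ⊢-conv d e = ≡-ty d (≡-sym e)

  S-rule-⨁ : ∀ {Γ t} (L : List⁺ A) (g : A → S) (f : A → Type) →
             All⁺.All (λ x → Γ ⊢ t ∶ f x) L → Γ ⊢ Σs L g • t ∶ ⨁ L (λ x → g x ·ᵀ f x)
  S-rule-⨁ {A = A} L g f ds = ⊢-cast (sumT-map L g f)
    (⊢-cast-scalar (trans (sumS-map (L⁺.map gf L) proj₁) (Σs-map L gf proj₁))
      (S-rule (L⁺.map gf L) (All⁺.map⁺ gf ds)))
    where
      gf : A → S × Type
      gf x = g x , f x

  map-wk-liftK : ∀ σ k Γ → L.map (substU (liftK k σ)) (L.map (wk k) Γ) ≡ L.map (wk k) (L.map (substU σ) Γ)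
  map-wk-liftK σ k Γ = trans (sym (Lₚ.map-∘ Γ)) (trans (Lₚ.map-cong (liftK-wk k σ) Γ) (Lₚ.map-∘ Γ))

  ∋-map : ∀ {Γ x U} (f : UType → UType) → Γ ∋ x ∶ U → L.map f Γ ∋ x ∶ f U
  ∋-map f here      = here
  ∋-map f (there p) = there (∋-map f p)

  mutual
    ⊢-substTy : ∀ σ {Γ t T} → Γ ⊢ t ∶ T → L.map (substU σ) Γ ⊢ t ∶ substT σ T
    ⊢-substTy σ (ax p)       = ax (∋-map (substU σ) p)
    ⊢-substTy σ (≡-ty d e)   = ≡-ty (⊢-substTy σ d) (substT-resp σ e)
    ⊢-substTy σ (→I d)       = →I (⊢-substTy σ d)
    ⊢-substTy σ (→E ks U αTs βAs d₁ d₂) = ⊢-conv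
      (→E ks _ _ _ (⊢-cast (substT-arrowSum σ ks U αTs) (⊢-substTy σ d₁))
                   (⊢-cast (substT-argSum σ ks U βAs) (⊢-substTy σ d₂)))
      (≡-sym (substT-resSum σ ks αTs βAs))
    ⊢-substTy σ {Γ} (∀I k αUs d) = ⊢-cast (sym (substT-sumU-quantify σ k αUs))
      (∀I k _ (⊢-cast-ctx (map-wk-liftK σ k Γ)
                           (⊢-cast (substT-sumU (liftK k σ) αUs) (⊢-substTy (liftK k σ) d))))
    ⊢-substTy σ (∀E k A αUs d) = ⊢-cast (sym (substT-sumU-instantiate σ k A αUs))
      (∀E k (substArg σ A) _ (⊢-cast (substT-sumU-quantify σ k αUs) (⊢-substTy σ d)))
    ⊢-substTy σ (+I d₁ d₂)   = +I (⊢-substTy σ d₁) (⊢-substTy σ d₂)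
    ⊢-substTy σ (1E d)       = 1E (⊢-substTy σ d)
    ⊢-substTy σ (S-rule αTs ds) =
      ⊢-cast (sym (trans (cong (substT σ) (sumT≡⨁ αTs)) (substT-⨁ σ αTs scaled)))
        (⊢-cast-scalar (sym (sumS-map αTs proj₁)) (S-rule-⨁ αTs proj₁ (substT σ ∘ proj₂) (⊢-substTy⁺ σ ds)))

    ⊢-substTy⁺ : ∀ σ {Γ t} {L : List⁺ (S × Type)} → All⁺.All (λ p → Γ ⊢ t ∶ proj₂ p) L →
                 All⁺.All (λ p → L.map (substU σ) Γ ⊢ t ∶ substT σ (proj₂ p)) L
    ⊢-substTy⁺ σ (d All⁺.∷ ds) = ⊢-substTy σ d All⁺.∷ ⊢-substTy* σ ds

    ⊢-substTy* : ∀ σ {Γ t} {L : List (S × Type)} → All (λ p → Γ ⊢ t ∶ proj₂ p) L →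
                 All (λ p → L.map (substU σ) Γ ⊢ t ∶ substT σ (proj₂ p)) L
    ⊢-substTy* σ []       = []
    ⊢-substTy* σ (d ∷ ds) = ⊢-substTy σ d ∷ ⊢-substTy* σ ds

  ⊢-wkTy : ∀ k {Γ t U} → Γ ⊢ t ∶ ⌜ U ⌝ → L.map (wk k) Γ ⊢ t ∶ ⌜ wk k U ⌝
  ⊢-wkTy k {Γ} d = ⊢-cast-ctx (Lₚ.map-cong (substU-wkEnv k) Γ)
    (⊢-cast (cong ⌜_⌝ (substU-wkEnv k _)) (⊢-substTy (wkEnv k) d))

  CtxEquiv : Ctx → Ctx → Set c
  CtxEquiv = Pointwise (λ U U' → ⌜ U ⌝ ≡ᵀ ⌜ U' ⌝)

  CtxEquiv-∋ : ∀ {Γ Δ x U} → CtxEquiv Γ Δ → Γ ∋ x ∶ U → Σ UType λ U' → Δ ∋ x ∶ U' × ⌜ U ⌝ ≡ᵀ ⌜ U' ⌝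
  CtxEquiv-∋ (e ∷ es) here      = _ , here , e
  CtxEquiv-∋ (e ∷ es) (there p) with CtxEquiv-∋ es p
  ... | U' , q , e' = U' , there q , e'

  mutual
    ⊢-ctx-resp : ∀ {Γ Δ t T} → CtxEquiv Γ Δ → Γ ⊢ t ∶ T → Δ ⊢ t ∶ T
    ⊢-ctx-resp Γ≋Δ (ax p) with CtxEquiv-∋ Γ≋Δ p
    ... | U' , q , e = ≡-ty (ax q) e
    ⊢-ctx-resp Γ≋Δ (≡-ty d e)   = ≡-ty (⊢-ctx-resp Γ≋Δ d) e
    ⊢-ctx-resp Γ≋Δ (→I d)       = →I (⊢-ctx-resp (≡-refl ∷ Γ≋Δ) d)
    ⊢-ctx-resp Γ≋Δ (→E ks U αTs βAs d₁ d₂) = →E ks U αTs βAs (⊢-ctx-resp Γ≋Δ d₁) (⊢-ctx-resp Γ≋Δ d₂)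
    ⊢-ctx-resp Γ≋Δ (∀I k αUs d) =
      ∀I k αUs (⊢-ctx-resp (Pointwise.map⁺ (wk k) (wk k) (Pointwise.map (wk-resp k) Γ≋Δ)) d)
    ⊢-ctx-resp Γ≋Δ (∀E k A αUs d) = ∀E k A αUs (⊢-ctx-resp Γ≋Δ d)
    ⊢-ctx-resp Γ≋Δ (+I d₁ d₂)   = +I (⊢-ctx-resp Γ≋Δ d₁) (⊢-ctx-resp Γ≋Δ d₂)
    ⊢-ctx-resp Γ≋Δ (1E d)       = 1E (⊢-ctx-resp Γ≋Δ d)
    ⊢-ctx-resp Γ≋Δ (S-rule αTs ds) = S-rule αTs (⊢-ctx-resp⁺ Γ≋Δ ds)

    ⊢-ctx-resp⁺ : ∀ {Γ Δ t} {L : List⁺ (S × Type)} → CtxEquiv Γ Δ →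
                  All⁺.All (λ p → Γ ⊢ t ∶ proj₂ p) L → All⁺.All (λ p → Δ ⊢ t ∶ proj₂ p) L
    ⊢-ctx-resp⁺ Γ≋Δ (d All⁺.∷ ds) = ⊢-ctx-resp Γ≋Δ d All⁺.∷ ⊢-ctx-resp* Γ≋Δ ds

    ⊢-ctx-resp* : ∀ {Γ Δ t} {L : List (S × Type)} → CtxEquiv Γ Δ →
                  All (λ p → Γ ⊢ t ∶ proj₂ p) L → All (λ p → Δ ⊢ t ∶ proj₂ p) L
    ⊢-ctx-resp* Γ≋Δ []       = []
    ⊢-ctx-resp* Γ≋Δ (d ∷ ds) = ⊢-ctx-resp Γ≋Δ d ∷ ⊢-ctx-resp* Γ≋Δ ds

  ∋-map⁻ : ∀ {Γ x V} (f : UType → UType) → L.map f Γ ∋ x ∶ V → Σ UType λ U → Γ ∋ x ∶ U × V ≡ f U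
  ∋-map⁻ {_ ∷ Γ} f here      = _ , here , refl
  ∋-map⁻ {_ ∷ Γ} f (there p) with ∋-map⁻ f p
  ... | U , q , e = U , there q , e

  _⊢ʳ_⇒_ : (ℕ → ℕ) → Ctx → Ctx → Set c
  ρ ⊢ʳ Γ ⇒ Δ = ∀ {x U} → Γ ∋ x ∶ U → Δ ∋ ρ x ∶ U

  ext-⊢ʳ : ∀ {Γ Δ V} ρ → ρ ⊢ʳ Γ ⇒ Δ → ext ρ ⊢ʳ (V ∷ Γ) ⇒ (V ∷ Δ)
  ext-⊢ʳ ρ ⊢ρ here      = here
  ext-⊢ʳ ρ ⊢ρ (there p) = there (⊢ρ p)

  wk-⊢ʳ : ∀ k {Γ Δ} ρ → ρ ⊢ʳ Γ ⇒ Δ → ρ ⊢ʳ L.map (wk k) Γ ⇒ L.map (wk k) Δ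
  wk-⊢ʳ k ρ ⊢ρ p with ∋-map⁻ (wk k) p
  ... | U , q , refl = ∋-map (wk k) (⊢ρ q)

  mutual
    ⊢-rename : ∀ {Γ Δ t T} ρ → ρ ⊢ʳ Γ ⇒ Δ → Γ ⊢ t ∶ T → Δ ⊢ rename ρ t ∶ T
    ⊢-rename ρ ⊢ρ (ax p)       = ax (⊢ρ p)
    ⊢-rename ρ ⊢ρ (≡-ty d e)   = ≡-ty (⊢-rename ρ ⊢ρ d) e
    ⊢-rename ρ ⊢ρ (→I d)       = →I (⊢-rename (ext ρ) (ext-⊢ʳ ρ ⊢ρ) d)
    ⊢-rename ρ ⊢ρ (→E ks U αTs βAs d₁ d₂) = →E ks U αTs βAs (⊢-rename ρ ⊢ρ d₁) (⊢-rename ρ ⊢ρ d₂)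
    ⊢-rename ρ ⊢ρ (∀I k αUs d) = ∀I k αUs (⊢-rename ρ (wk-⊢ʳ k ρ ⊢ρ) d)
    ⊢-rename ρ ⊢ρ (∀E k A αUs d) = ∀E k A αUs (⊢-rename ρ ⊢ρ d)
    ⊢-rename ρ ⊢ρ (+I d₁ d₂)   = +I (⊢-rename ρ ⊢ρ d₁) (⊢-rename ρ ⊢ρ d₂)
    ⊢-rename ρ ⊢ρ (1E d)       = 1E (⊢-rename ρ ⊢ρ d)
    ⊢-rename ρ ⊢ρ (S-rule αTs ds) = S-rule αTs (⊢-rename⁺ ρ ⊢ρ ds)

    ⊢-rename⁺ : ∀ {Γ Δ t} {L : List⁺ (S × Type)} ρ → ρ ⊢ʳ Γ ⇒ Δ →
                All⁺.All (λ p → Γ ⊢ t ∶ proj₂ p) L → All⁺.All (λ p → Δ ⊢ rename ρ t ∶ proj₂ p) L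
    ⊢-rename⁺ ρ ⊢ρ (d All⁺.∷ ds) = ⊢-rename ρ ⊢ρ d All⁺.∷ ⊢-rename* ρ ⊢ρ ds

    ⊢-rename* : ∀ {Γ Δ t} {L : List (S × Type)} ρ → ρ ⊢ʳ Γ ⇒ Δ →
                All (λ p → Γ ⊢ t ∶ proj₂ p) L → All (λ p → Δ ⊢ rename ρ t ∶ proj₂ p) L
    ⊢-rename* ρ ⊢ρ []       = []
    ⊢-rename* ρ ⊢ρ (d ∷ ds) = ⊢-rename ρ ⊢ρ d ∷ ⊢-rename* ρ ⊢ρ ds

  _⊢ˢ_⇒_ : (ℕ → Term) → Ctx → Ctx → Set c
  σ ⊢ˢ Γ ⇒ Δ = ∀ {x U} → Γ ∋ x ∶ U → Δ ⊢ σ x ∶ ⌜ U ⌝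

  exts-⊢ˢ : ∀ {Γ Δ V} σ → σ ⊢ˢ Γ ⇒ Δ → exts σ ⊢ˢ (V ∷ Γ) ⇒ (V ∷ Δ)
  exts-⊢ˢ σ ⊢σ here      = ax here
  exts-⊢ˢ σ ⊢σ (there p) = ⊢-rename suc there (⊢σ p)

  wk-⊢ˢ : ∀ k {Γ Δ} σ → σ ⊢ˢ Γ ⇒ Δ → σ ⊢ˢ L.map (wk k) Γ ⇒ L.map (wk k) Δ
  wk-⊢ˢ k σ ⊢σ p with ∋-map⁻ (wk k) p
  ... | U , q , refl = ⊢-wkTy k (⊢σ q)

  mutual
    ⊢-sub : ∀ {Γ Δ t T} σ → σ ⊢ˢ Γ ⇒ Δ → Γ ⊢ t ∶ T → Δ ⊢ sub σ t ∶ T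
    ⊢-sub σ ⊢σ (ax p)       = ⊢σ p
    ⊢-sub σ ⊢σ (≡-ty d e)   = ≡-ty (⊢-sub σ ⊢σ d) e
    ⊢-sub σ ⊢σ (→I d)       = →I (⊢-sub (exts σ) (exts-⊢ˢ σ ⊢σ) d)
    ⊢-sub σ ⊢σ (→E ks U αTs βAs d₁ d₂) = →E ks U αTs βAs (⊢-sub σ ⊢σ d₁) (⊢-sub σ ⊢σ d₂)
    ⊢-sub σ ⊢σ (∀I k αUs d) = ∀I k αUs (⊢-sub σ (wk-⊢ˢ k σ ⊢σ) d)
    ⊢-sub σ ⊢σ (∀E k A αUs d) = ∀E k A αUs (⊢-sub σ ⊢σ d)
    ⊢-sub σ ⊢σ (+I d₁ d₂)   = +I (⊢-sub σ ⊢σ d₁) (⊢-sub σ ⊢σ d₂)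
    ⊢-sub σ ⊢σ (1E d)       = 1E (⊢-sub σ ⊢σ d)
    ⊢-sub σ ⊢σ (S-rule αTs ds) = S-rule αTs (⊢-sub⁺ σ ⊢σ ds)

    ⊢-sub⁺ : ∀ {Γ Δ t} {L : List⁺ (S × Type)} σ → σ ⊢ˢ Γ ⇒ Δ →
             All⁺.All (λ p → Γ ⊢ t ∶ proj₂ p) L → All⁺.All (λ p → Δ ⊢ sub σ t ∶ proj₂ p) L
    ⊢-sub⁺ σ ⊢σ (d All⁺.∷ ds) = ⊢-sub σ ⊢σ d All⁺.∷ ⊢-sub* σ ⊢σ ds

    ⊢-sub* : ∀ {Γ Δ t} {L : List (S × Type)} σ → σ ⊢ˢ Γ ⇒ Δ →
             All (λ p → Γ ⊢ t ∶ proj₂ p) L → All (λ p → Δ ⊢ sub σ t ∶ proj₂ p) L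
    ⊢-sub* σ ⊢σ []       = []
    ⊢-sub* σ ⊢σ (d ∷ ds) = ⊢-sub σ ⊢σ d ∷ ⊢-sub* σ ⊢σ ds

  ⊢-[] : ∀ {Γ U t T b} → (U ∷ Γ) ⊢ t ∶ T → Γ ⊢ b ∶ ⌜ U ⌝ → Γ ⊢ t [ b ] ∶ T
  ⊢-[] {Γ} {U} {b = b} d ⊢b = ⊢-sub (single b) ⊢single d
    where
      ⊢single : single b ⊢ˢ (U ∷ Γ) ⇒ Γ
      ⊢single here      = ⊢b
      ⊢single (there p) = ax p

  -- Combinations of typings and their transport along images

  record Combination (Γ : Ctx) (t : Term) (m : S) (X : Type) : Set c where
    constructor combination
    field
      family  : List⁺ (S × Type)
      weight  : Σs family proj₁ ≡ m
      typings : All⁺.All (λ p → Γ ⊢ t ∶ proj₂ p) family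
      type≡ᵀ  : X ≡ᵀ ⨁ family scaled

  combination-single : ∀ {Γ t T} → Γ ⊢ t ∶ T → Combination Γ t 1ₛ T
  combination-single {T = T} d = combination ((1ₛ , T) ∷ []) refl (d All⁺.∷ []) (≡-sym ≡-one)

  combination-resp : ∀ {Γ t m X Y} → Combination Γ t m X → X ≡ᵀ Y → Combination Γ t m Y
  combination-resp (combination L w ds e) X≡Y = combination L w ds (≡-trans (≡-sym X≡Y) e)

  combination-cast : ∀ {Γ t m m' X} → m ≡ m' → Combination Γ t m X → Combination Γ t m' X
  combination-cast refl c = c

  combination-scale : ∀ {Γ t m X} α → Combination Γ t m X → Combination Γ t (α ×ₛ m) (α ·ᵀ X)
  combination-scale α (combination L w ds e) = combination
    (L⁺.map (λ (β , T) → α ×ₛ β , T) L)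
    (trans (Σs-map L _ proj₁) (trans (sym (Σs-homo (α ×ₛ_) (λ _ _ → distribˡ α _ _) L proj₁)) (cong (α ×ₛ_) w)))
    (All⁺.map⁺ _ ds)
    (≡-trans (≡-scal e) (≡-trans (·ᵀ-distrib-⨁ α L scaled)
      (≡-trans (⨁-cong L (λ _ → ≡-mul)) (≡-sym (≡-reflexive (⨁-map L _ scaled))))))

  combination-plus : ∀ {Γ t m m' X Y} → Combination Γ t m X → Combination Γ t m' Y →
                     Combination Γ t (m +ₛ m') (X +ᵀ Y)
  combination-plus (combination L w ds e) (combination L' w' ds' e') = combination
    (L ⁺++⁺ L') (trans (Σs-++ L L' proj₁) (cong₂ _+ₛ_ w w')) (All⁺.++⁺ ds ds')
    (≡-trans (≡-plus e e') (≡-sym (⨁-++ L L' scaled)))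

  combination-⨁ : ∀ {Γ t} (M : List⁺ A) (g : A → S) (F : A → Type) →
                  All⁺.All (λ x → Combination Γ t (g x) (F x)) M → Combination Γ t (Σs M g) (⨁ M F)
  combination-⨁ {Γ = Γ} {t} (x ∷ xs) g F (c All⁺.∷ cs) = go x xs c cs
    where
      go : ∀ x xs → Combination Γ t (g x) (F x) → All (λ x → Combination Γ t (g x) (F x)) xs →
           Combination Γ t (Σs∷ x xs g) (⨁∷ x xs F)
      go x []       c []        = c
      go x (y ∷ ys) c (c' ∷ cs) = combination-plus c (go y ys c' cs)

  combination-sound : ∀ {Γ t m X} → Combination Γ t m X → Γ ⊢ m • t ∶ X
  combination-sound (combination L w ds e) = ⊢-conv (⊢-cast-scalar w (S-rule-⨁ L proj₁ proj₂ ds)) (≡-sym e)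

  combination-sound₁ : ∀ {Γ t X} → Combination Γ t 1ₛ X → Γ ⊢ t ∶ X
  combination-sound₁ = 1E ∘ combination-sound

  Split : Ctx → Term → Term → S → Type → Set c
  Split Γ t r m X = Σ Type λ X₁ → Σ Type λ X₂ →
                    Combination Γ t m X₁ × Combination Γ r m X₂ × X ≡ᵀ X₁ +ᵀ X₂

  split-resp : ∀ {Γ t r m X Y} → Split Γ t r m X → X ≡ᵀ Y → Split Γ t r m Y
  split-resp (X₁ , X₂ , c₁ , c₂ , e) X≡Y = X₁ , X₂ , c₁ , c₂ , ≡-trans (≡-sym X≡Y) e

  split-cast : ∀ {Γ t r m m' X} → m ≡ m' → Split Γ t r m X → Split Γ t r m' X
  split-cast refl s = s

  split-scale : ∀ {Γ t r m X} α → Split Γ t r m X → Split Γ t r (α ×ₛ m) (α ·ᵀ X)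
  split-scale α (X₁ , X₂ , c₁ , c₂ , e) =
    α ·ᵀ X₁ , α ·ᵀ X₂ , combination-scale α c₁ , combination-scale α c₂ , ≡-trans (≡-scal e) (≡-sym ≡-dist)

  split-plus : ∀ {Γ t r m m' X Y} → Split Γ t r m X → Split Γ t r m' Y → Split Γ t r (m +ₛ m') (X +ᵀ Y)
  split-plus (X₁ , X₂ , c₁ , c₂ , e) (Y₁ , Y₂ , c₁' , c₂' , e') =
    X₁ +ᵀ Y₁ , X₂ +ᵀ Y₂ , combination-plus c₁ c₁' , combination-plus c₂ c₂' ,
    ≡-trans (≡-plus e e') (interchangeᵀ _ _ _ _)

  split-⨁ : ∀ {Γ t r} (M : List⁺ A) (g : A → S) (F : A → Type) →
            All⁺.All (λ x → Split Γ t r (g x) (F x)) M → Split Γ t r (Σs M g) (⨁ M F)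
  split-⨁ {Γ = Γ} {t} {r} (x ∷ xs) g F (s All⁺.∷ ss) = go x xs s ss
    where
      go : ∀ x xs → Split Γ t r (g x) (F x) → All (λ x → Split Γ t r (g x) (F x)) xs →
           Split Γ t r (Σs∷ x xs g) (⨁∷ x xs F)
      go x []       s []        = s
      go x (y ∷ ys) s (s' ∷ ss) = split-plus s (go y ys s' ss)

  module Transport {I : Set c} (source : I → UType) (target : I → Type) where

    sourceSum targetSum : List⁺ (S × I) → Type
    sourceSum L = ⨁ L (λ (β , i) → β ·ᵀ ⌜ source i ⌝)
    targetSum L = ⨁ L (λ (β , i) → β ·ᵀ target i)

    -- Image γ X P: the unit summands of γ·X can be redistributed, with the same total
    -- weights, over (equivalents of) sources, and P is the matching combination of targets.
    UnitImage : S → UType → Type → Set c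
    UnitImage γ V P = Σ (List⁺ (S × I)) λ L →
      Σs L proj₁ ≡ γ × All⁺.All (λ (_ , i) → ⌜ V ⌝ ≡ᵀ ⌜ source i ⌝) L × P ≡ᵀ targetSum L

    Image : S → Type → Type → Set c
    Image γ ⌜ V ⌝    P = UnitImage γ V P
    Image γ (α ·ᵀ T) P = Image (γ ×ₛ α) T P
    Image γ (T +ᵀ R) P = Σ Type λ P₁ → Σ Type λ P₂ → Image γ T P₁ × Image γ R P₂ × P ≡ᵀ P₁ +ᵀ P₂
    Image γ (gvar x) P = Poly.⊥

    Image-resp-target : ∀ γ T {P P'} → Image γ T P → P ≡ᵀ P' → Image γ T P'
    Image-resp-target γ ⌜ V ⌝    (L , w , vs , e)        P≡P' = L , w , vs , ≡-trans (≡-sym P≡P') e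
    Image-resp-target γ (α ·ᵀ T) img                     P≡P' = Image-resp-target (γ ×ₛ α) T img P≡P'
    Image-resp-target γ (T +ᵀ R) (P₁ , P₂ , i₁ , i₂ , e) P≡P' = P₁ , P₂ , i₁ , i₂ , ≡-trans (≡-sym P≡P') e

    Image-cast : ∀ {γ γ'} T {P} → γ ≡ γ' → Image γ T P → Image γ' T P
    Image-cast T refl img = img

    Image-+ : ∀ a b T {P₁ P₂} → Image a T P₁ → Image b T P₂ → Image (a +ₛ b) T (P₁ +ᵀ P₂)
    Image-+ a b ⌜ V ⌝ (L₁ , w₁ , vs₁ , e₁) (L₂ , w₂ , vs₂ , e₂) =
      L₁ ⁺++⁺ L₂ , trans (Σs-++ L₁ L₂ proj₁) (cong₂ _+ₛ_ w₁ w₂) , All⁺.++⁺ vs₁ vs₂ ,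
      ≡-trans (≡-plus e₁ e₂) (≡-sym (⨁-++ L₁ L₂ _))
    Image-+ a b (α ·ᵀ T) i₁ i₂ = Image-cast T (sym (distribʳ α a b)) (Image-+ (a ×ₛ α) (b ×ₛ α) T i₁ i₂)
    Image-+ a b (T +ᵀ R) (P₁ , P₂ , i₁ , i₂ , e) (Q₁ , Q₂ , j₁ , j₂ , e') =
      P₁ +ᵀ Q₁ , P₂ +ᵀ Q₂ , Image-+ a b T i₁ j₁ , Image-+ a b R i₂ j₂ ,
      ≡-trans (≡-plus e e') (interchangeᵀ _ _ _ _)

    -- Only the head coefficient is split: it keeps all of the weight except β b.
    Image-split : ∀ a β b T {P} → Image (a +ₛ (β ×ₛ b)) T P →
                  Σ Type λ P₁ → Σ Type λ P₂ → Image a T P₁ × Image b T P₂ × P ≡ᵀ P₁ +ᵀ β ·ᵀ P₂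
    Image-split a β b ⌜ V ⌝ (((x , i) ∷ xs) , w , (v All⁺.∷ vs) , e) =
      targetSum L₁ , b ·ᵀ target i ,
      (L₁ , weight₁ , (v All⁺.∷ vs) , ≡-refl) , (((b , i) ∷ []) , refl , (v All⁺.∷ []) , ≡-refl) ,
      ≡-trans e (≡-trans (≡-reflexive (cong (λ y → ⨁∷ (y , i) xs _) (sym (x-y+y≡x x (β ×ₛ b)))))
                         (≡-trans (⨁∷-head xs _ (≡-sym ≡-fact)) (≡-plus ≡-refl (≡-sym ≡-mul))))
      where
        L₁ : List⁺ (S × I)
        L₁ = (x +ₛ (-ₛ (β ×ₛ b)) , i) ∷ xs
        weight₁ : Σs L₁ proj₁ ≡ a
        weight₁ = trans (Σs∷-head xs proj₁ refl) (trans (cong (_+ₛ (-ₛ (β ×ₛ b))) w) (x+y-y≡x a (β ×ₛ b)))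
    Image-split a β b (α ·ᵀ T) img =
      Image-split (a ×ₛ α) β (b ×ₛ α) T
        (Image-cast T (trans (distribʳ α a (β ×ₛ b)) (cong (a ×ₛ α +ₛ_) (*-assoc β b α))) img)
    Image-split a β b (T +ᵀ R) (Q₁ , Q₂ , i₁ , i₂ , e)
      with Image-split a β b T i₁ | Image-split a β b R i₂
    ... | P₁ , P₂ , j₁ , j₂ , e₁ | P₁' , P₂' , j₁' , j₂' , e₂ =
      P₁ +ᵀ P₁' , P₂ +ᵀ P₂' , (P₁ , P₁' , j₁ , j₁' , ≡-refl) , (P₂ , P₂' , j₂ , j₂' , ≡-refl) ,
      ≡-trans e (≡-trans (≡-plus e₁ e₂) (≡-trans (interchangeᵀ _ _ _ _) (≡-plus ≡-refl ≡-dist)))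

    UnitImage-resp : ∀ {γ V V' P} → ⌜ V ⌝ ≡ᵀ ⌜ V' ⌝ → UnitImage γ V P → UnitImage γ V' P
    UnitImage-resp V≡V' (L , w , vs , e) = L , w , All⁺.map (≡-trans (≡-sym V≡V')) vs , e

    Image-resp : ∀ {T R} → T ≡ᵀ R → ∀ γ P → Image γ T P ⇔ Image γ R P
    Image-resp ≡-refl        γ P = ⇔.refl
    Image-resp (≡-sym p)     γ P = ⇔.sym (Image-resp p γ P)
    Image-resp (≡-trans p q) γ P = ⇔.trans (Image-resp p γ P) (Image-resp q γ P)
    Image-resp (≡-one {T})   γ P = mk⇔ (Image-cast T (*-identityʳ γ)) (Image-cast T (sym (*-identityʳ γ)))
    Image-resp (≡-mul {α} {β} {T}) γ P =
      mk⇔ (Image-cast T (*-assoc γ α β)) (Image-cast T (sym (*-assoc γ α β)))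
    Image-resp ≡-dist        γ P = ⇔.refl
    Image-resp (≡-fact {α} {β} {T}) γ P = mk⇔
      (λ (P₁ , P₂ , i₁ , i₂ , e) →
        Image-resp-target _ T (Image-cast T (sym (distribˡ γ α β)) (Image-+ _ _ T i₁ i₂)) (≡-sym e))
      (λ img → let (P₁ , P₂ , i₁ , i₂ , e) = Image-split (γ ×ₛ α) 1ₛ (γ ×ₛ β) T
                     (Image-cast T (trans (distribˡ γ α β) (cong (γ ×ₛ α +ₛ_) (sym (*-identityˡ _)))) img)
               in P₁ , P₂ , i₁ , i₂ , ≡-trans e (≡-plus ≡-refl ≡-one))
    Image-resp ≡-comm        γ P = mk⇔
      (λ (P₁ , P₂ , i₁ , i₂ , e) → P₂ , P₁ , i₂ , i₁ , ≡-trans e ≡-comm)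
      (λ (P₁ , P₂ , i₁ , i₂ , e) → P₂ , P₁ , i₂ , i₁ , ≡-trans e ≡-comm)
    Image-resp ≡-assoc       γ P = mk⇔
      (λ (P₁ , P₂ , i₁ , (Q₁ , Q₂ , j₁ , j₂ , e') , e) →
        P₁ +ᵀ Q₁ , Q₂ , (P₁ , Q₁ , i₁ , j₁ , ≡-refl) , j₂ , ≡-trans e (≡-trans (≡-plus ≡-refl e') ≡-assoc))
      (λ (P₁ , P₂ , (Q₁ , Q₂ , j₁ , j₂ , e') , i₂ , e) →
        Q₁ , Q₂ +ᵀ P₂ , j₁ , (Q₂ , P₂ , j₂ , i₂ , ≡-refl) ,
        ≡-trans e (≡-trans (≡-plus e' ≡-refl) (≡-sym ≡-assoc)))
    Image-resp (≡-scal {α} p) γ P = Image-resp p (γ ×ₛ α) P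
    Image-resp (≡-plus p q)  γ P = mk⇔
      (λ (P₁ , P₂ , i₁ , i₂ , e) →
        P₁ , P₂ , Equivalence.to (Image-resp p γ P₁) i₁ , Equivalence.to (Image-resp q γ P₂) i₂ , e)
      (λ (P₁ , P₂ , i₁ , i₂ , e) →
        P₁ , P₂ , Equivalence.from (Image-resp p γ P₁) i₁ , Equivalence.from (Image-resp q γ P₂) i₂ , e)
    Image-resp (≡-arrow p q) γ P = mk⇔ (UnitImage-resp (≡-arrow p q)) (UnitImage-resp (≡-sym (≡-arrow p q)))
    Image-resp (≡-allu p)    γ P = mk⇔ (UnitImage-resp (≡-allu p)) (UnitImage-resp (≡-sym (≡-allu p)))
    Image-resp (≡-allg p)    γ P = mk⇔ (UnitImage-resp (≡-allg p)) (UnitImage-resp (≡-sym (≡-allg p)))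

    Image-normal : ∀ γ T {P} → Image γ T P → Σ (List⁺ (S × I)) λ L → γ ·ᵀ T ≡ᵀ sourceSum L × P ≡ᵀ targetSum L
    Image-normal γ ⌜ V ⌝ (L , w , vs , e) = L ,
      ≡-trans (≡-reflexive (cong (_·ᵀ ⌜ V ⌝) (sym w)))
        (≡-trans (⨁-homo (_·ᵀ ⌜ V ⌝) (λ _ _ → ≡-sym ≡-fact) L proj₁) (⨁-congᴬ L (All⁺.map ≡-scal vs))) ,
      e
    Image-normal γ (α ·ᵀ T) img with Image-normal (γ ×ₛ α) T img
    ... | L , e₁ , e₂ = L , ≡-trans ≡-mul e₁ , e₂
    Image-normal γ (T +ᵀ R) (P₁ , P₂ , i₁ , i₂ , e) with Image-normal γ T i₁ | Image-normal γ R i₂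
    ... | L₁ , e₁ , e₁' | L₂ , e₂ , e₂' =
      L₁ ⁺++⁺ L₂ , ≡-trans (≡-sym ≡-dist) (≡-trans (≡-plus e₁ e₂) (≡-sym (⨁-++ L₁ L₂ _))) ,
      ≡-trans e (≡-trans (≡-plus e₁' e₂') (≡-sym (⨁-++ L₁ L₂ _)))

    Image-diagonal : ∀ M → Image 1ₛ (sourceSum M) (targetSum M)
    Image-diagonal (x ∷ xs) = go x xs
      where
        unit : ∀ x → Image 1ₛ (proj₁ x ·ᵀ ⌜ source (proj₂ x) ⌝) (proj₁ x ·ᵀ target (proj₂ x))
        unit x = (x ∷ []) , sym (*-identityˡ _) , (≡-refl All⁺.∷ []) , ≡-refl
        go : ∀ x xs → Image 1ₛ (⨁∷ x xs (λ (β , i) → β ·ᵀ ⌜ source i ⌝)) (⨁∷ x xs (λ (β , i) → β ·ᵀ target i))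
        go x []       = unit x
        go x (y ∷ ys) = _ , _ , unit x , go y ys , ≡-refl

    module _ {Γ Δ t t'} (convert : ∀ L → Δ ⊢ t ∶ sourceSum L → Γ ⊢ t' ∶ targetSum L) where

      retype : ∀ {T Q} → Δ ⊢ t ∶ T → Image 1ₛ T Q → Γ ⊢ t' ∶ Q
      retype {T} d img with Image-normal 1ₛ T img
      ... | L , 1T≡ , Q≡ = ⊢-conv (convert L (⊢-conv d (≡-trans (≡-sym ≡-one) 1T≡))) (≡-sym Q≡)

      -- convert only applies to typings of weight 1, so γ·T is treated as 1·T + (γ - 1)·T.
      retype-scaled : ∀ {γ T P} → Δ ⊢ t ∶ T → Image 1ₛ (γ ·ᵀ T) P → Combination Γ t' γ P
      retype-scaled {γ} {T} d img
        with Image-split 1ₛ (γ +ₛ (-ₛ 1ₛ)) 1ₛ T (Image-cast T (trans (*-identityˡ γ) (sym (1+[x-1]1≡x γ))) img)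
      ... | P₁ , P₂ , i₁ , i₂ , P≡ = combination-resp
        (combination-cast (1+[x-1]1≡x γ) (combination-plus (combination-single (retype d i₁))
                                             (combination-scale _ (combination-single (retype d i₂)))))
        (≡-sym P≡)

      transfer : ∀ {m X Y} → Combination Δ t m X → Image 1ₛ X Y → Combination Γ t' m Y
      transfer {Y = Y} (combination (x ∷ xs) w (d All⁺.∷ ds) X≡) img =
        combination-cast w (go x xs d ds (Equivalence.to (Image-resp X≡ 1ₛ Y) img))
        where
          go : ∀ x xs {Y} → Δ ⊢ t ∶ proj₂ x → All (λ p → Δ ⊢ t ∶ proj₂ p) xs →
               Image 1ₛ (⨁∷ x xs scaled) Y → Combination Γ t' (Σs∷ x xs proj₁) Y
          go x []       d []        img                      = retype-scaled d img
          go x (y ∷ ys) d (d' ∷ ds) (P₁ , P₂ , i₁ , i₂ , e) =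
            combination-resp (combination-plus (retype-scaled d i₁) (go y ys d' ds i₂)) (≡-sym e)

    transfer-split : ∀ {Γ Δ t t' r r' m X Y} →
                     (∀ L → Δ ⊢ t ∶ sourceSum L → Γ ⊢ t' ∶ targetSum L) →
                     (∀ L → Δ ⊢ r ∶ sourceSum L → Γ ⊢ r' ∶ targetSum L) →
                     Split Δ t r m X → Image 1ₛ X Y → Split Γ t' r' m Y
    transfer-split {Y = Y} convertₜ convertᵣ (X₁ , X₂ , c₁ , c₂ , X≡) img
      with Equivalence.to (Image-resp X≡ 1ₛ Y) img
    ... | Y₁ , Y₂ , i₁ , i₂ , Y≡ = Y₁ , Y₂ , transfer convertₜ c₁ i₁ , transfer convertᵣ c₂ i₂ , Y≡

  module Quantify (k : Kind) = Transport {UType} id (λ U → ⌜ ∀[ k ] U ⌝)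
  module Instantiate (k : Kind) (A : Arg k) = Transport {UType} ∀[ k ]_ (λ U → ⌜ U [ A /]U ⌝)

  quantify-convert : ∀ k {Γ t} L → L.map (wk k) Γ ⊢ t ∶ Quantify.sourceSum k L → Γ ⊢ t ∶ Quantify.targetSum k L
  quantify-convert k L d = ⊢-cast (sumU-map L proj₁ _) (∀I k L (⊢-cast (sym (sumU≡⨁ L)) d))

  quantify-image : ∀ k αUs → Quantify.Image k 1ₛ (sumU αUs) (sumU (L⁺.map (quantify k) αUs))
  quantify-image k αUs =
    P.subst₂ (Quantify.Image k 1ₛ) (sym (sumU≡⨁ αUs)) (sym (sumU-map αUs proj₁ _))
             (Quantify.Image-diagonal k αUs)

  instantiate-convert : ∀ k (A : Arg k) {Γ t} L →
                        Γ ⊢ t ∶ Instantiate.sourceSum k A L → Γ ⊢ t ∶ Instantiate.targetSum k A L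
  instantiate-convert k A L d = ⊢-cast (sumU-map L proj₁ _) (∀E k A L (⊢-cast (sym (sumU-map L proj₁ _)) d))

  instantiate-image : ∀ k (A : Arg k) αUs →
    Instantiate.Image k A 1ₛ (sumU (L⁺.map (quantify k) αUs)) (sumU (L⁺.map (instantiate k A) αUs))
  instantiate-image k A αUs = P.subst₂ (Instantiate.Image k A 1ₛ)
    (sym (sumU-map αUs proj₁ _)) (sym (sumU-map αUs proj₁ _)) (Instantiate.Image-diagonal k A αUs)

  -- Generation lemmas

  -- Generalising from α • t to towers of scalars makes rule 1E, whose premise is 1 • s,
  -- amenable to induction.
  data Scaled (t : Term) : Term → S → Set c where
    base : Scaled t t 1ₛ
    step : ∀ {s m} γ → Scaled t s m → Scaled t (γ • s) (γ ×ₛ m)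

  sumS-×ₛ : ∀ (L : List⁺ (S × Type)) m → Σs L (λ p → proj₁ p ×ₛ m) ≡ sumS (L⁺.map proj₁ L) ×ₛ m
  sumS-×ₛ L m =
    trans (sym (Σs-homo (_×ₛ m) (λ _ _ → distribʳ m _ _) L proj₁)) (cong (_×ₛ m) (sym (sumS-map L proj₁)))

  mutual
    scaled-generation : ∀ {Γ t s m X} → Scaled t s m → Γ ⊢ s ∶ X → Combination Γ t m X
    scaled-generation base d = combination-single d
    scaled-generation (step γ ss) (≡-ty d e) = combination-resp (scaled-generation (step γ ss) d) (≡-sym e)
    scaled-generation (step γ ss) (1E d) =
      combination-cast (*-identityˡ _) (scaled-generation (step 1ₛ (step γ ss)) d)
    scaled-generation (step γ ss) (∀I k αUs d) =
      Quantify.transfer k (quantify-convert k) (scaled-generation (step γ ss) d) (quantify-image k αUs)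
    scaled-generation (step γ ss) (∀E k A αUs d) =
      Instantiate.transfer k A (instantiate-convert k A) (scaled-generation (step γ ss) d)
                           (instantiate-image k A αUs)
    scaled-generation (step {m = m} _ ss) (S-rule αTs ds) = combination-resp
      (combination-cast (sumS-×ₛ αTs m)
                        (combination-⨁ αTs (λ p → proj₁ p ×ₛ m) scaled (scaled-generation⁺ ss ds)))
      (≡-sym (≡-reflexive (sumT≡⨁ αTs)))

    scaled-generation⁺ : ∀ {Γ t s m} {L : List⁺ (S × Type)} → Scaled t s m →
                         All⁺.All (λ p → Γ ⊢ s ∶ proj₂ p) L →
                         All⁺.All (λ p → Combination Γ t (proj₁ p ×ₛ m) (scaled p)) L
    scaled-generation⁺ ss (d All⁺.∷ ds) =
      combination-scale _ (scaled-generation ss d) All⁺.∷ scaled-generation* ss ds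

    scaled-generation* : ∀ {Γ t s m} {L : List (S × Type)} → Scaled t s m → All (λ p → Γ ⊢ s ∶ proj₂ p) L →
                         All (λ p → Combination Γ t (proj₁ p ×ₛ m) (scaled p)) L
    scaled-generation* ss []       = []
    scaled-generation* ss (d ∷ ds) = combination-scale _ (scaled-generation ss d) ∷ scaled-generation* ss ds

  •-generation : ∀ {Γ α t X} → Γ ⊢ α • t ∶ X → Combination Γ t α X
  •-generation d = combination-cast (*-identityʳ _) (scaled-generation (step _ base) d)

  mutual
    sum-generation : ∀ {Γ t r s m X} → Scaled (t ⊕ r) s m → Γ ⊢ s ∶ X → Split Γ t r m X
    sum-generation base (+I d₁ d₂) = _ , _ , combination-single d₁ , combination-single d₂ , ≡-refl
    sum-generation ss (≡-ty d e)   = split-resp (sum-generation ss d) (≡-sym e)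
    sum-generation ss (1E d)       = split-cast (*-identityˡ _) (sum-generation (step 1ₛ ss) d)
    sum-generation ss (∀I k αUs d) =
      Quantify.transfer-split k (quantify-convert k) (quantify-convert k) (sum-generation ss d)
                              (quantify-image k αUs)
    sum-generation ss (∀E k A αUs d) =
      Instantiate.transfer-split k A (instantiate-convert k A) (instantiate-convert k A)
        (sum-generation ss d) (instantiate-image k A αUs)
    sum-generation (step {m = m} _ ss) (S-rule αTs ds) = split-resp
      (split-cast (sumS-×ₛ αTs m) (split-⨁ αTs (λ p → proj₁ p ×ₛ m) scaled (sum-generation⁺ ss ds)))
      (≡-sym (≡-reflexive (sumT≡⨁ αTs)))

    sum-generation⁺ : ∀ {Γ t r s m} {L : List⁺ (S × Type)} → Scaled (t ⊕ r) s m →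
                      All⁺.All (λ p → Γ ⊢ s ∶ proj₂ p) L →
                      All⁺.All (λ p → Split Γ t r (proj₁ p ×ₛ m) (scaled p)) L
    sum-generation⁺ ss (d All⁺.∷ ds) = split-scale _ (sum-generation ss d) All⁺.∷ sum-generation* ss ds

    sum-generation* : ∀ {Γ t r s m} {L : List (S × Type)} → Scaled (t ⊕ r) s m →
                      All (λ p → Γ ⊢ s ∶ proj₂ p) L → All (λ p → Split Γ t r (proj₁ p ×ₛ m) (scaled p)) L
    sum-generation* ss []       = []
    sum-generation* ss (d ∷ ds) = split-scale _ (sum-generation ss d) ∷ sum-generation* ss ds

  ⊕-generation : ∀ {Γ t r X} → Γ ⊢ t ⊕ r ∶ X → Split Γ t r 1ₛ X
  ⊕-generation = sum-generation base

  -- Basis terms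

  record SummandInvariant (b : Term) (P : Ctx → UType → Set c) : Set c where
    field
      P-var  : ∀ {Γ x U} → b ≡ var x → Γ ∋ x ∶ U → P Γ U
      P-lam  : ∀ {Γ t U T} → b ≡ ƛ t → (U ∷ Γ) ⊢ t ∶ T → P Γ (U ⇒ T)
      P-resp : ∀ {Γ V V'} → ⌜ V ⌝ ≡ᵀ ⌜ V' ⌝ → P Γ V → P Γ V'
      P-∀I   : ∀ k {Γ U} → P (L.map (wk k) Γ) U → P Γ (∀[ k ] U)
      P-∀E   : ∀ k (A : Arg k) {Γ U} → P Γ (∀[ k ] U) → P Γ (U [ A /]U)

  module _ {b P} (inv : SummandInvariant b P) where
    open SummandInvariant inv

    mutual
      unit-summands : ∀ {Γ s m X} → Basis b → Scaled b s m → Γ ⊢ s ∶ X → AllUnits (P Γ) X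
      unit-summands bb base (ax p)      = P-var refl p
      unit-summands bb base (→I d)      = P-lam refl d
      unit-summands bb ss (≡-ty d e)    = Equivalence.from (AllUnits-resp P-resp e) (unit-summands bb ss d)
      unit-summands bb ss (1E d)        = unit-summands bb (step 1ₛ ss) d
      unit-summands bb ss (∀I k αUs d)  = AllUnits-sumU⁺ (L⁺.map (quantify k) αUs)
        (All⁺.map⁺ (quantify k) (All⁺.map (P-∀I k) (AllUnits-sumU⁻ αUs (unit-summands bb ss d))))
      unit-summands bb ss (∀E k A αUs d) = AllUnits-sumU⁺ (L⁺.map (instantiate k A) αUs)
        (All⁺.map⁺ (instantiate k A) (All⁺.map (P-∀E k A)
          (All⁺.map⁻ (quantify k) (AllUnits-sumU⁻ (L⁺.map (quantify k) αUs) (unit-summands bb ss d)))))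
      unit-summands bb (step _ ss) (S-rule αTs ds) = AllUnits-sumT⁺ αTs (unit-summands⁺ bb ss ds)
      unit-summands () base (→E _ _ _ _ _ _)
      unit-summands () base (+I _ _)
      unit-summands () base (S-rule _ _)

      unit-summands⁺ : ∀ {Γ s m} {L : List⁺ (S × Type)} → Basis b → Scaled b s m →
                       All⁺.All (λ p → Γ ⊢ s ∶ proj₂ p) L → All⁺.All (λ p → AllUnits (P Γ) (proj₂ p)) L
      unit-summands⁺ bb ss (d All⁺.∷ ds) = unit-summands bb ss d All⁺.∷ unit-summands* bb ss ds

      unit-summands* : ∀ {Γ s m} {L : List (S × Type)} → Basis b → Scaled b s m →
                       All (λ p → Γ ⊢ s ∶ proj₂ p) L → All (λ p → AllUnits (P Γ) (proj₂ p)) L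
      unit-summands* bb ss []       = []
      unit-summands* bb ss (d ∷ ds) = unit-summands bb ss d ∷ unit-summands* bb ss ds

  mass-sumU : ∀ L → mass (sumU L) ≡ Σs L (λ (α , _) → α ×ₛ 1ₛ)
  mass-sumU L = trans (cong mass (sumU≡⨁ L)) (mass-⨁ L scaledU)

  mass-sumU-map₂ : ∀ (f : UType → UType) L → mass (sumU (L⁺.map (map₂ f) L)) ≡ mass (sumU L)
  mass-sumU-map₂ f L =
    trans (mass-sumU (L⁺.map (map₂ f) L)) (trans (Σs-map L (map₂ f) (λ (α , _) → α ×ₛ 1ₛ)) (sym (mass-sumU L)))

  mutual
    basis-mass : ∀ {Γ b s m X} → Basis b → Scaled b s m → Γ ⊢ s ∶ X → mass X ≡ m
    basis-mass bb base (ax p)         = refl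
    basis-mass bb base (→I d)         = refl
    basis-mass bb ss (≡-ty d e)       = trans (mass-resp e) (basis-mass bb ss d)
    basis-mass bb ss (1E d)           = trans (basis-mass bb (step 1ₛ ss) d) (*-identityˡ _)
    basis-mass bb ss (∀I k αUs d)     = trans (mass-sumU-map₂ ∀[ k ]_ αUs) (basis-mass bb ss d)
    basis-mass bb ss (∀E k A αUs d)   =
      trans (mass-sumU-map₂ (_[ A /]U) αUs) (trans (sym (mass-sumU-map₂ ∀[ k ]_ αUs)) (basis-mass bb ss d))
    basis-mass bb (step {m = m} _ ss) (S-rule αTs ds) =
      trans (cong mass (sumT≡⨁ αTs)) (trans (mass-⨁ αTs scaled) (trans (Σs-congᴬ αTs (basis-mass⁺ bb ss ds))
        (sumS-×ₛ αTs m)))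
    basis-mass () base (→E _ _ _ _ _ _)
    basis-mass () base (+I _ _)
    basis-mass () base (S-rule _ _)

    basis-mass⁺ : ∀ {Γ b s m} {L : List⁺ (S × Type)} → Basis b → Scaled b s m →
                  All⁺.All (λ p → Γ ⊢ s ∶ proj₂ p) L →
                  All⁺.All (λ p → proj₁ p ×ₛ mass (proj₂ p) ≡ proj₁ p ×ₛ m) L
    basis-mass⁺ bb ss (d All⁺.∷ ds) = cong (_ ×ₛ_) (basis-mass bb ss d) All⁺.∷ basis-mass* bb ss ds

    basis-mass* : ∀ {Γ b s m} {L : List (S × Type)} → Basis b → Scaled b s m →
                  All (λ p → Γ ⊢ s ∶ proj₂ p) L → All (λ p → proj₁ p ×ₛ mass (proj₂ p) ≡ proj₁ p ×ₛ m) L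
    basis-mass* bb ss []       = []
    basis-mass* bb ss (d ∷ ds) = cong (_ ×ₛ_) (basis-mass bb ss d) ∷ basis-mass* bb ss ds

  typing-invariant : ∀ b → SummandInvariant b (λ Γ V → Γ ⊢ b ∶ ⌜ V ⌝)
  typing-invariant b = record
    { P-var  = λ { refl p → ax p }
    ; P-lam  = λ { refl d → →I d }
    ; P-resp = λ V≡V' d → ⊢-conv d V≡V'
    ; P-∀I   = λ k d → ⊢-conv (∀I k ((1ₛ , _) ∷ []) (⊢-conv d (≡-sym ≡-one))) ≡-one
    ; P-∀E   = λ k A d → ⊢-conv (∀E k A ((1ₛ , _) ∷ []) (⊢-conv d (≡-sym ≡-one))) ≡-one
    }

  AbstractionType : Ctx → Term → UType → Set c
  AbstractionType Γ t V = Σ (List Kind) λ ks → Σ UType λ A → Σ Type λ B →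
    ⌜ V ⌝ ≡ᵀ ⌜ ∀⃗ ks (A ⇒ B) ⌝ × (∀ As → (substsU ks As A ∷ Γ) ⊢ t ∶ substsT ks As B)

  AbstractionType-resp : ∀ {Γ t V V'} → ⌜ V ⌝ ≡ᵀ ⌜ V' ⌝ → AbstractionType Γ t V → AbstractionType Γ t V'
  AbstractionType-resp V≡V' (ks , A , B , e , body) = ks , A , B , ≡-trans (≡-sym V≡V') e , body

  AbstractionType-∀I : ∀ {t} k {Γ U} → AbstractionType (L.map (wk k) Γ) t U → AbstractionType Γ t (∀[ k ] U)
  AbstractionType-∀I {t} k {Γ} (ks , A , B , e , body) = k ∷ ks , A , B , ∀[ k ]-cong e , body'
    where
      body' : ∀ As → (substsU (k ∷ ks) As A ∷ Γ) ⊢ t ∶ substsT (k ∷ ks) As B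
      body' (A₀ ∷ As) = ⊢-cast-ctx
        (cong₂ _∷_ (instantiate-substsU-wkAll k A₀ ks As A)
                   (trans (sym (Lₚ.map-∘ Γ)) (trans (Lₚ.map-cong (instantiate-wk k A₀) Γ) (Lₚ.map-id Γ))))
        (⊢-cast (instantiate-substsT-wkAll k A₀ ks As B) (⊢-substTy (extend k A₀ idEnv) (body (wkAll k As))))

  AbstractionType-∀E : ∀ {t} k (A₀ : Arg k) {Γ U} →
                       AbstractionType Γ t (∀[ k ] U) → AbstractionType Γ t (U [ A₀ /]U)
  AbstractionType-∀E {t} k A₀ {Γ} (ks , A , B , e , body) with ∀[]≡ᵀ∀⃗⇒-inversion k ks e
  ... | ks' , refl , e' = ks' , substU σ A , substT σ B ,
    ≡-trans (substT-resp (extend k A₀ idEnv) e')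
            (≡-reflexive (cong ⌜_⌝ (substU-∀⃗ (extend k A₀ idEnv) ks' (A ⇒ B)))) ,
    λ As → ⊢-cast-ctx (cong (_∷ Γ) (sym (substsU-liftKs k A₀ ks' As A)))
                      (⊢-cast (sym (substsT-liftKs k A₀ ks' As B)) (body (A₀ ∷ As)))
    where
      σ : Env
      σ = liftKs ks' (extend k A₀ idEnv)

  abstraction-invariant : ∀ t → SummandInvariant (ƛ t) (λ Γ → AbstractionType Γ t)
  abstraction-invariant t = record
    { P-var  = λ ()
    ; P-lam  = λ { {U = U} {T} refl d →
        [] , U , T , ≡-refl ,
        λ { [] → ⊢-cast-ctx (cong (_∷ _) (sym (substU-id U))) (⊢-cast (sym (substT-id T)) d) } }
    ; P-resp = AbstractionType-resp
    ; P-∀I   = AbstractionType-∀I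
    ; P-∀E   = AbstractionType-∀E
    }

  split-sound : ∀ {Γ t r m X} → Split Γ t r m X → Γ ⊢ m • t ⊕ m • r ∶ X
  split-sound (X₁ , X₂ , c₁ , c₂ , e) = ⊢-conv (+I (combination-sound c₁) (combination-sound c₂)) (≡-sym e)

  split-sound₁ : ∀ {Γ t r X} → Split Γ t r 1ₛ X → Γ ⊢ t ⊕ r ∶ X
  split-sound₁ (X₁ , X₂ , c₁ , c₂ , e) = ⊢-conv (+I (combination-sound₁ c₁) (combination-sound₁ c₂)) (≡-sym e)

  resSum≡ᵀ⨁⨁-swapped : ∀ ks αTs βAs →
    resSum ks αTs βAs ≡ᵀ ⨁ βAs (λ (β , As) → β ·ᵀ ⨁ αTs (λ (α , T) → α ·ᵀ substsT ks As T))
  resSum≡ᵀ⨁⨁-swapped ks αTs βAs = begin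
    resSum ks αTs βAs
      ≈⟨ resSum≡ᵀ⨁⨁ ks αTs βAs ⟩
    ⨁ αTs (λ (α , T) → α ·ᵀ ⨁ βAs (λ (β , As) → β ·ᵀ substsT ks As T))
      ≈⟨ ⨁-cong αTs (λ (α , _) → ·ᵀ-distrib-⨁ α βAs _) ⟩
    ⨁ αTs (λ (α , T) → ⨁ βAs (λ (β , As) → α ·ᵀ β ·ᵀ substsT ks As T))
      ≈⟨ ⨁-swap αTs βAs _ ⟩
    ⨁ βAs (λ (β , As) → ⨁ αTs (λ (α , T) → α ·ᵀ β ·ᵀ substsT ks As T))
      ≈⟨ ⨁-cong βAs (λ (β , As) → ⨁-cong αTs λ (α , T) →
           ≡-trans ≡-mul (≡-trans (≡-reflexive (cong (_·ᵀ substsT ks As T) (*-comm α β))) (≡-sym ≡-mul))) ⟩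
    ⨁ βAs (λ (β , As) → ⨁ αTs (λ (α , T) → β ·ᵀ α ·ᵀ substsT ks As T))
      ≈⟨ ⨁-cong βAs (λ (β , _) → ·ᵀ-distrib-⨁ β αTs _) ⟨
    ⨁ βAs (λ (β , As) → β ·ᵀ ⨁ αTs (λ (α , T) → α ·ᵀ substsT ks As T)) ∎
    where open ≡ᵀ-Reasoning

  module FunctionSide (ks : List Kind) (U : UType) (βAs : List⁺ (S × All Arg ks)) =
    Transport (λ T → ∀⃗ ks (U ⇒ T)) (λ T → ⨁ βAs (λ (β , As) → β ·ᵀ substsT ks As T))

  module ArgumentSide (ks : List Kind) (U : UType) (αTs : List⁺ (S × Type)) =
    Transport (λ As → substsU ks As U) (λ As → ⨁ αTs (λ (α , T) → α ·ᵀ substsT ks As T))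

  function-side-image : ∀ ks U αTs βAs → FunctionSide.Image ks U βAs 1ₛ (arrowSum ks U αTs) (resSum ks αTs βAs)
  function-side-image ks U αTs βAs = FunctionSide.Image-resp-target ks U βAs 1ₛ (arrowSum ks U αTs)
    (subst (λ X → FunctionSide.Image ks U βAs 1ₛ X _) (sym (arrowSum≡⨁ ks U αTs))
           (FunctionSide.Image-diagonal ks U βAs αTs))
    (≡-sym (resSum≡ᵀ⨁⨁ ks αTs βAs))

  function-side-convert : ∀ {Γ t r} ks U βAs → Γ ⊢ r ∶ argSum ks U βAs →
    ∀ αTs → Γ ⊢ t ∶ FunctionSide.sourceSum ks U βAs αTs → Γ ⊢ app t r ∶ FunctionSide.targetSum ks U βAs αTs
  function-side-convert ks U βAs ⊢r αTs ⊢t =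
    ⊢-conv (→E ks U αTs βAs (⊢-cast (sym (arrowSum≡⨁ ks U αTs)) ⊢t) ⊢r) (resSum≡ᵀ⨁⨁ ks αTs βAs)

  argument-side-image : ∀ ks U αTs βAs → ArgumentSide.Image ks U αTs 1ₛ (argSum ks U βAs) (resSum ks αTs βAs)
  argument-side-image ks U αTs βAs = ArgumentSide.Image-resp-target ks U αTs 1ₛ (argSum ks U βAs)
    (subst (λ X → ArgumentSide.Image ks U αTs 1ₛ X _) (sym (argSum≡⨁ ks U βAs))
           (ArgumentSide.Image-diagonal ks U αTs βAs))
    (≡-sym (resSum≡ᵀ⨁⨁-swapped ks αTs βAs))

  argument-side-convert : ∀ {Γ t r} ks U αTs → Γ ⊢ t ∶ arrowSum ks U αTs →
    ∀ βAs → Γ ⊢ r ∶ ArgumentSide.sourceSum ks U αTs βAs → Γ ⊢ app t r ∶ ArgumentSide.targetSum ks U αTs βAs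
  argument-side-convert ks U αTs ⊢t βAs ⊢r =
    ⊢-conv (→E ks U αTs βAs ⊢t (⊢-cast (sym (argSum≡⨁ ks U βAs)) ⊢r)) (resSum≡ᵀ⨁⨁-swapped ks αTs βAs)

  abstraction-bodies : ∀ {Γ t} ks U αTs → Γ ⊢ ƛ t ∶ arrowSum ks U αTs →
    All⁺.All (λ (_ , T) → ∀ As → (substsU ks As U ∷ Γ) ⊢ t ∶ substsT ks As T) αTs
  abstraction-bodies {Γ} {t} ks U αTs ⊢λ = All⁺.map instances (AllUnits-⨁⁻ αTs _
    (subst (AllUnits (AbstractionType Γ t)) (arrowSum≡⨁ ks U αTs)
           (unit-summands (abstraction-invariant t) (lam t) base ⊢λ)))
    where
      instances : ∀ {T} → AbstractionType Γ t (∀⃗ ks (U ⇒ T)) →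
                  ∀ As → (substsU ks As U ∷ Γ) ⊢ t ∶ substsT ks As T
      instances (ks' , A , B , e , body) As with ∀⃗⇒-injective ks ks' e
      ... | refl , U≡A , T≡B = ⊢-ctx-resp (substT-resp σ (≡-sym U≡A) ∷ Pointwise.refl ≡-refl)
                                          (⊢-conv (body As) (substT-resp σ (≡-sym T≡B)))
        where
          σ : Env
          σ = envOf ks As idEnv

  basis-arguments : ∀ {Γ b} ks U βAs → Basis b → Γ ⊢ b ∶ argSum ks U βAs →
                    All⁺.All (λ (_ , As) → Γ ⊢ b ∶ ⌜ substsU ks As U ⌝) βAs
  basis-arguments {Γ} {b} ks U βAs bb ⊢b = AllUnits-⨁⁻ βAs _
    (subst (AllUnits (λ V → Γ ⊢ b ∶ ⌜ V ⌝)) (argSum≡⨁ ks U βAs) (unit-summands (typing-invariant b) bb base ⊢b))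

  basis-weight : ∀ {Γ b} → Basis b → (L : List⁺ (S × A)) (f : A → UType) →
                 Γ ⊢ b ∶ sumU (L⁺.map (map₂ f) L) → Σs L (λ (α , _) → α ×ₛ 1ₛ) ≡ 1ₛ
  basis-weight bb L f ⊢b = trans (sym (Σs-map L (map₂ f) (λ (α , _) → α ×ₛ 1ₛ)))
    (trans (sym (mass-sumU (L⁺.map (map₂ f) L))) (basis-mass bb base ⊢b))

  -- Both sums of types have mass 1, since they are types of basis terms; this lets the
  -- doubly indexed family of instances of the body be collected by rule S with weight 1.
  app-β : ∀ {Γ t b} ks U αTs βAs → Basis b → Γ ⊢ ƛ t ∶ arrowSum ks U αTs → Γ ⊢ b ∶ argSum ks U βAs →
          Γ ⊢ t [ b ] ∶ resSum ks αTs βAs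
  app-β {Γ} {t} {b} ks U αTs βAs bb ⊢λ ⊢b =
    ⊢-conv (combination-sound₁ (combination-cast weight all-instances)) (≡-sym (resSum≡ᵀ⨁⨁ ks αTs βAs))
    where
      instances : ∀ T → (∀ As → (substsU ks As U ∷ Γ) ⊢ t ∶ substsT ks As T) →
                  Combination Γ (t [ b ]) (Σs βAs (λ (β , _) → β ×ₛ 1ₛ))
                              (⨁ βAs (λ (β , As) → β ·ᵀ substsT ks As T))
      instances T body = combination-⨁ βAs _ _ (All⁺.map (λ {q} ⊢bᵢ →
          combination-scale (proj₁ q) (combination-single (⊢-[] (body (proj₂ q)) ⊢bᵢ)))
        (basis-arguments ks U βAs bb ⊢b))

      all-instances : Combination Γ (t [ b ]) (Σs αTs (λ (α , _) → α ×ₛ Σs βAs (λ (β , _) → β ×ₛ 1ₛ)))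
                        (⨁ αTs (λ (α , T) → α ·ᵀ ⨁ βAs (λ (β , As) → β ·ᵀ substsT ks As T)))
      all-instances = combination-⨁ αTs _ _ (All⁺.map (λ {p} body →
        combination-scale (proj₁ p) (instances (proj₂ p) body)) (abstraction-bodies ks U αTs ⊢λ))

      weight : Σs αTs (λ (α , _) → α ×ₛ Σs βAs (λ (β , _) → β ×ₛ 1ₛ)) ≡ 1ₛ
      weight = trans (Σs-cong αTs (λ (α , _) → cong (α ×ₛ_) (basis-weight bb βAs _ ⊢b)))
                     (basis-weight (lam t) αTs _ ⊢λ)

  app-distl : ∀ {Γ t r u} ks U αTs βAs → Γ ⊢ t ⊕ r ∶ arrowSum ks U αTs → Γ ⊢ u ∶ argSum ks U βAs →
              Γ ⊢ app t u ⊕ app r u ∶ resSum ks αTs βAs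
  app-distl ks U αTs βAs ⊢t⊕r ⊢u = split-sound₁ (FunctionSide.transfer-split ks U βAs
    (function-side-convert ks U βAs ⊢u) (function-side-convert ks U βAs ⊢u)
    (⊕-generation ⊢t⊕r) (function-side-image ks U αTs βAs))

  app-distr : ∀ {Γ t r u} ks U αTs βAs → Γ ⊢ t ∶ arrowSum ks U αTs → Γ ⊢ r ⊕ u ∶ argSum ks U βAs →
              Γ ⊢ app t r ⊕ app t u ∶ resSum ks αTs βAs
  app-distr ks U αTs βAs ⊢t ⊢r⊕u = split-sound₁ (ArgumentSide.transfer-split ks U αTs
    (argument-side-convert ks U αTs ⊢t) (argument-side-convert ks U αTs ⊢t)
    (⊕-generation ⊢r⊕u) (argument-side-image ks U αTs βAs))

  app-scall : ∀ {Γ α t r} ks U αTs βAs → Γ ⊢ α • t ∶ arrowSum ks U αTs → Γ ⊢ r ∶ argSum ks U βAs →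
              Γ ⊢ α • app t r ∶ resSum ks αTs βAs
  app-scall ks U αTs βAs ⊢αt ⊢r = combination-sound (FunctionSide.transfer ks U βAs
    (function-side-convert ks U βAs ⊢r) (•-generation ⊢αt) (function-side-image ks U αTs βAs))

  app-scalr : ∀ {Γ α t r} ks U αTs βAs → Γ ⊢ t ∶ arrowSum ks U αTs → Γ ⊢ α • r ∶ argSum ks U βAs →
              Γ ⊢ α • app t r ∶ resSum ks αTs βAs
  app-scalr ks U αTs βAs ⊢t ⊢αr = combination-sound (ArgumentSide.transfer ks U αTs
    (argument-side-convert ks U αTs ⊢t) (•-generation ⊢αr) (argument-side-image ks U αTs βAs))

  mutual
    subject-reduction : ∀ {Γ t t' T} → t ⟶ t' → Γ ⊢ t ∶ T → Γ ⊢ t' ∶ T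
    subject-reduction E-one d = 1E d
    subject-reduction E-mul d =
      combination-sound (combination-cast (cong (_ ×ₛ_) (*-identityʳ _))
                                          (scaled-generation (step _ (step _ base)) d))
    subject-reduction E-dist d = split-sound (split-cast (*-identityʳ _) (sum-generation (step _ base) d))
    subject-reduction r (≡-ty d e)     = ≡-ty (subject-reduction r d) e
    subject-reduction r (∀I k αUs d)   = ∀I k αUs (subject-reduction r d)
    subject-reduction r (∀E k A αUs d) = ∀E k A αUs (subject-reduction r d)
    subject-reduction r (1E d)         = 1E (subject-reduction (ξ-scal r) d)
    subject-reduction F-fact  (+I d₁ d₂) =
      combination-sound (combination-plus (•-generation d₁) (•-generation d₂))
    subject-reduction F-fact¹ (+I d₁ d₂) =
      combination-sound (combination-plus (•-generation d₁) (combination-single d₂))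
    subject-reduction F-fact² (+I d₁ d₂) =
      combination-sound (combination-plus (combination-single d₁) (combination-single d₂))
    subject-reduction A-distl     (→E ks U αTs βAs d₁ d₂) = app-distl ks U αTs βAs d₁ d₂
    subject-reduction A-distr     (→E ks U αTs βAs d₁ d₂) = app-distr ks U αTs βAs d₁ d₂
    subject-reduction A-scall     (→E ks U αTs βAs d₁ d₂) = app-scall ks U αTs βAs d₁ d₂
    subject-reduction A-scalr     (→E ks U αTs βAs d₁ d₂) = app-scalr ks U αTs βAs d₁ d₂
    subject-reduction (B-beta bb) (→E ks U αTs βAs d₁ d₂) = app-β ks U αTs βAs bb d₁ d₂
    subject-reduction (ξ-scal r)  (S-rule αTs ds)         = S-rule αTs (subject-reduction⁺ r ds)
    subject-reduction (ξ-plus r)  (+I d₁ d₂)              = +I d₁ (subject-reduction r d₂)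
    subject-reduction (ξ-appr r)  (→E ks U αTs βAs d₁ d₂) = →E ks U αTs βAs d₁ (subject-reduction r d₂)
    subject-reduction (ξ-appl r)  (→E ks U αTs βAs d₁ d₂) = →E ks U αTs βAs (subject-reduction r d₁) d₂
    subject-reduction (ξ-lam r)   (→I d)                  = →I (subject-reduction r d)

    subject-reduction⁺ : ∀ {Γ t t'} {L : List⁺ (S × Type)} → t ⟶ t' →
                         All⁺.All (λ p → Γ ⊢ t ∶ proj₂ p) L → All⁺.All (λ p → Γ ⊢ t' ∶ proj₂ p) L
    subject-reduction⁺ r (d All⁺.∷ ds) = subject-reduction r d All⁺.∷ subject-reduction* r ds

    subject-reduction* : ∀ {Γ t t'} {L : List (S × Type)} → t ⟶ t' →
                         All (λ p → Γ ⊢ t ∶ proj₂ p) L → All (λ p → Γ ⊢ t' ∶ proj₂ p) L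
    subject-reduction* r []       = []
    subject-reduction* r (d ∷ ds) = subject-reduction r d ∷ subject-reduction* r ds

theorem1 : ∀ {c : Level} (R : CRing c) → let open Calculus R in
    ∀ {Γ : Ctx} {t t' : Term} {T : Type}
    → t ⟶ t' → Γ ⊢ t ∶ T → Γ ⊢ t' ∶ T
theorem1 = subject-reduction
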